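{- Let $H_1,H_2$ be hyperplanes of $T$ and let $a,b\in V'$ with $ra\notin H_1$, $rb\notin H_2$, such that $C(H_1,a)$ and $C(H_2,b)$ are distinct classes of the partition $\Pi(2e,K)$. Then $[a]$ and $[b]$ have $q^{4e-2}+q^{4e-3}-q^{4e-4}-q^{4e-5}-q^{2e-2}+q^{2e-3}$ common neighbours in $X(2e,K)$.
   Context: Let $e\geq 2$ and let $K$ be a finite commutative ring with identity having precisely three ideals $\{0\}$, $J=\langle r\rangle$, $K$, with $K/J\cong\mathbb{F}_q$ ($q$ a prime power). Let $K^\times$ be the set of units, $V'$ the set of tuples in $K^{2e}$ with at least one entry in $K^\times$, for $a\in V'$ let $[a]=\{\lambda a:\lambda\in K^\times\}$, and $V=\{[a]:a\in V'\}$. For $a,b\in K^{2e}$ let $\langle a,b\rangle=\sum_{i=1}^e(a_ib_{e+i}-a_{e+i}b_i)$. The graph $X(2e,K)$ has vertex set $V$, $[a]\sim[b]$ iff $\langle a,b\rangle\in K\setminus\{0\}$. Let $T=J^{2e}$, a $2e$-dimensional vector space over $K/J$ with $(z+J)\cdot x=zx$; a hyperplane is a $(2e-1)$-dimensional subspace. For $u\in K^{2e}$, $ru\in T$ is the componentwise product. For a hyperplane $H$ and $u\in V'$ with $ru\notin H$, $C(H,u)=\{[u+h]:h\in H\}$; these sets form a partition of $V$, denoted $\Pi(2e,K)$. -}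

module Defs where

open import Level using (Level; _⊔_; 0ℓ)
open import Algebra.Bundles using (CommutativeRing)
open import Data.Nat as ℕ using (ℕ; _≤_; _∸_; _^_)
open import Data.Nat.Primality using (Prime)
open import Data.Integer as ℤ using (ℤ)
open import Data.Fin using (Fin; _↑ˡ_; _↑ʳ_)
open import Data.Product using (Σ; ∃; ∃-syntax; _×_; _,_)
open import Data.Sum using (_⊎_)
open import Data.Unit.Polymorphic using (⊤)
open import Relation.Nullary using (¬_)
open import Relation.Unary using (Pred; _≐_)
open import Relation.Binary.PropositionalEquality using (_≡_)
open import Function.Bundles using (_⇔_)
import Algebra.Properties.CommutativeMonoid.Sum as SumProps

IsPrimePower : ℕ → Set
IsPrimePower q = ∃[ p ] ∃[ k ] (Prime p × 1 ≤ k × q ≡ p ^ k)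

commonNeighbourFormula : ℕ → ℕ → ℤ
commonNeighbourFormula q e =
  ((((ℤ.+ (q ^ (4 ℕ.* e ∸ 2)) ℤ.+ ℤ.+ (q ^ (4 ℕ.* e ∸ 3)))
     ℤ.- ℤ.+ (q ^ (4 ℕ.* e ∸ 4))) ℤ.- ℤ.+ (q ^ (4 ℕ.* e ∸ 5)))
     ℤ.- ℤ.+ (q ^ (2 ℕ.* e ∸ 2))) ℤ.+ ℤ.+ (q ^ (2 ℕ.* e ∸ 3))

module _ {c ℓ : Level} (K : CommutativeRing c ℓ) where
  open CommutativeRing K
  open SumProps +-commutativeMonoid using (sum)

  IsFiniteRing : Set (c ⊔ ℓ)
  IsFiniteRing = ∃[ n ] Σ (Fin n → Carrier) λ f → ∀ x → ∃[ i ] (x ≈ f i)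

  IsUnit : Pred Carrier (c ⊔ ℓ)
  IsUnit x = ∃[ y ] (x * y ≈ 1#)

  record IsIdeal {ℓi : Level} (I : Pred Carrier ℓi) : Set (c ⊔ ℓ ⊔ ℓi) where
    field
      resp  : ∀ {x y} → x ≈ y → I x → I y
      zero∈ : I 0#
      +-cl  : ∀ {x y} → I x → I y → I (x + y)
      *-cl  : ∀ k {x} → I x → I (k * x)

  ZeroIdeal : Pred Carrier ℓ
  ZeroIdeal x = x ≈ 0#

  FullIdeal : Pred Carrier 0ℓ
  FullIdeal _ = ⊤

  PrincipalIdeal : Carrier → Pred Carrier (c ⊔ ℓ)
  PrincipalIdeal r x = ∃[ y ] (x ≈ y * r)

  ExactlyThreeIdeals : Carrier → Set (Level.suc (c ⊔ ℓ))
  ExactlyThreeIdeals r =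
    (∀ (I : Pred Carrier (c ⊔ ℓ)) → IsIdeal I →
       (I ≐ ZeroIdeal) ⊎ (I ≐ PrincipalIdeal r) ⊎ (I ≐ FullIdeal))
    × ¬ (PrincipalIdeal r ≐ ZeroIdeal)
    × ¬ (PrincipalIdeal r ≐ FullIdeal)

  -- K/J has exactly q elements: q representatives, pairwise incongruent mod J, covering K
  ResidueFieldSize : Carrier → ℕ → Set (c ⊔ ℓ)
  ResidueFieldSize r q =
    Σ (Fin q → Carrier) λ t →
      (∀ i j → PrincipalIdeal r (t i - t j) → i ≡ j)
      × (∀ x → ∃[ i ] PrincipalIdeal r (x - t i))

  -- K^{2e}; coordinate i (1≤i≤e) is  i ↑ˡ e,  coordinate e+i is  e ↑ʳ i
  record Vect (e : ℕ) : Set c where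
    constructor mkVect
    field coord : Fin (e ℕ.+ e) → Carrier
  open Vect public

  module _ {e : ℕ} where
    _≈ᵥ_ : Vect e → Vect e → Set ℓ
    u ≈ᵥ v = ∀ j → coord u j ≈ coord v j

    _+ᵥ_ : Vect e → Vect e → Vect e
    u +ᵥ v = mkVect (λ j → coord u j + coord v j)

    _·ᵥ_ : Carrier → Vect e → Vect e
    z ·ᵥ u = mkVect (λ j → z * coord u j)

    0ᵥ : Vect e
    0ᵥ = mkVect (λ _ → 0#)

    ⟨_,_⟩ : Vect e → Vect e → Carrier
    ⟨ a , b ⟩ = sum (λ (i : Fin e) →
                  coord a (i ↑ˡ e) * coord b (e ↑ʳ i) - coord a (e ↑ʳ i) * coord b (i ↑ˡ e))

    InV' : Pred (Vect e) (c ⊔ ℓ)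
    InV' a = ∃[ j ] IsUnit (coord a j)

    SameVertex : Vect e → Vect e → Set (c ⊔ ℓ)
    SameVertex a b = ∃[ λ' ] (IsUnit λ' × b ≈ᵥ (λ' ·ᵥ a))

    Adjacent : Vect e → Vect e → Set ℓ
    Adjacent a b = ¬ (⟨ a , b ⟩ ≈ 0#)

    -- "the vertices satisfying P form exactly N classes of V":
    -- N representatives in V', pairwise in distinct classes, each satisfying P,
    -- and every element of V' satisfying P lies in the class of one of them
    HasVertexCount : ∀ {ℓp} → Pred (Vect e) ℓp → ℕ → Set (c ⊔ ℓ ⊔ ℓp)
    HasVertexCount P N =
      Σ (Fin N → Vect e) λ w →
        (∀ i → InV' (w i) × P (w i))
        × (∀ i j → SameVertex (w i) (w j) → i ≡ j)
        × (∀ x → InV' x → P x → ∃[ i ] SameVertex (w i) x)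

    CommonNeighbour : Vect e → Vect e → Pred (Vect e) ℓ
    CommonNeighbour a b x = Adjacent a x × Adjacent b x

  module _ (r : Carrier) (e : ℕ) where
    InT : Pred (Vect e) (c ⊔ ℓ)
    InT t = ∀ j → PrincipalIdeal r (coord t j)

    -- linear combination Σ_i z_i b_i (scalars from K act on T through K/J)
    linComb : ∀ {n} → (Fin n → Carrier) → (Fin n → Vect e) → Vect e
    linComb z w = mkVect (λ j → sum (λ i → z i * coord (w i) j))

    record IsSubspace {ℓh : Level} (H : Pred (Vect e) ℓh) : Set (c ⊔ ℓ ⊔ ℓh) where
      field
        resp  : ∀ {u v} → u ≈ᵥ v → H u → H v
        ⊆T    : ∀ {u} → H u → InT u
        zero∈ : H 0ᵥ
        +-cl  : ∀ {u v} → H u → H v → H (u +ᵥ v)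
        ·-cl  : ∀ z {u} → H u → H (z ·ᵥ u)

    -- w is a basis (over K/J) of H; coefficients z ∈ K are taken modulo J
    IsBasis : ∀ {ℓh n} → Pred (Vect e) ℓh → (Fin n → Vect e) → Set (c ⊔ ℓ ⊔ ℓh)
    IsBasis H w =
      (∀ i → H (w i))
      × (∀ z → linComb z w ≈ᵥ 0ᵥ → ∀ i → PrincipalIdeal r (z i))
      × (∀ h → H h → ∃[ z ] (h ≈ᵥ linComb z w))

    IsHyperplane : ∀ {ℓh} → Pred (Vect e) ℓh → Set (c ⊔ ℓ ⊔ ℓh)
    IsHyperplane H = IsSubspace H × Σ (Fin ((e ℕ.+ e) ∸ 1) → Vect e) (IsBasis H)

    InClassC : ∀ {ℓh} → Pred (Vect e) ℓh → Vect e → Pred (Vect e) (c ⊔ ℓ ⊔ ℓh)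
    InClassC H u x = ∃[ h ] (H h × SameVertex x (u +ᵥ h))

    SameClassC : ∀ {ℓh} → Pred (Vect e) ℓh → Vect e → Pred (Vect e) ℓh → Vect e → Set (c ⊔ ℓ ⊔ ℓh)
    SameClassC H₁ a H₂ b = ∀ x → InV' x → (InClassC H₁ a x ⇔ InClassC H₂ b x)

{-# OPTIONS --safe #-}
module Submission where

-- K is local with maximal ideal J = ⟨r⟩ and J² = 0, so |K| = q², |J| = q and |K^×| = q² − q.
-- If r b is a unit multiple of r a, then C(H₁,a) and C(H₂,b) both consist of the [x] with
-- r x ∈ K^× r a (this uses T = H ⊕ K r u, which holds by counting), contradicting the hypothesis.
-- Otherwise x ↦ (⟨a,x⟩, ⟨b,x⟩) maps K^{2e} onto K², with kernel of size q^{4e−4}. So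
-- (q² − 1)² q^{4e−4} vectors have both values nonzero; those outside V' are the r y with both
-- values of y units, (q² − q)² q^{2e−4} of them. Units act freely on the remaining ones, each orbit
-- containing exactly one vector whose first unit coordinate is 1, so dividing by q² − q counts
-- the common neighbours.

open import Level using (Level; _⊔_; 0ℓ)
open import Algebra.Bundles using (CommutativeRing; RawRing)
open import Algebra.Solver.Ring.AlmostCommutativeRing using (fromCommutativeRing; _-Raw-AlmostCommutative⟶_)
import Algebra.Solver.Ring as RingSolver
open import Data.Bool using (if_then_else_)
open import Data.Empty using (⊥-elim)
open import Data.Fin as Fin using (Fin; zero; suc; splitAt; join; remQuot; combine; _↑ˡ_; _↑ʳ_)
import Data.Fin.Properties as Finₚ
open import Data.Integer as ℤ using (ℤ; +_; -[1+_])
import Data.Integer.Properties as ℤₚ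
import Data.Integer.Tactic.RingSolver as ℤ-Solver
open import Data.Maybe using (Maybe; just; nothing)
open import Data.Nat as ℕ using (ℕ; zero; suc; _∸_; _≤_; s≤s; z≤n)
import Data.Nat.Properties as ℕₚ
import Data.Nat.Tactic.RingSolver as ℕ-Solver
open import Data.Nat.Primality using (prime⇒nonTrivial; prime⇒nonZero)
open import Data.Product as Prod using (Σ; ∃; ∃-syntax; _×_; _,_; proj₁; proj₂)
open import Data.Product.Relation.Binary.Pointwise.NonDependent using (×-setoid)
open import Data.Sign as Sign using (Sign)
open import Data.Sum as Sum using (_⊎_; inj₁; inj₂; [_,_]′)
open import Data.Unit using (tt)
open import Data.Vec.Functional using (removeAt; replicate)
import Data.Vec.Functional.Relation.Binary.Equality.Setoid as VecEq
open import Function using (id; _∘_; _$_)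
open import Function.Bundles using (mk⇔)
open import Relation.Binary using (Setoid; Decidable; _Respects_)
open import Relation.Binary.PropositionalEquality as ≡ using (_≡_; _≢_)
open import Relation.Nullary using (¬_; yes; no; ¬?; does; contradiction)
open import Relation.Nullary.Decidable using (_×-dec_; toSum)
open import Relation.Unary using (Pred; U; ∁; _∩_; _∪_; _⊆_; _≐_; _⟨×⟩_) renaming (Decidable to Decidable₁)
open import Defs hiding (_≈ᵥ_; _+ᵥ_; _·ᵥ_)

-- Constants such as 1# or - 1# only normalise when the coefficients compute, so the solver
-- takes its coefficients from ℤ, interpreted in R by n ↦ n × 1#.
module IntegerSolver {c ℓ} (R : CommutativeRing c ℓ) where
  open CommutativeRing R
  open import Algebra.Properties.Ring ring using (-0#≈0#; -‿involutive; -‿+-comm; -‿distribˡ-*; -‿distribʳ-*)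
  open import Algebra.Properties.Semiring.Mult.TCOptimised semiring
    using (×-homo-+; ×1-homo-*; ×-cong; 1+×) renaming (_×_ to _×ₙ_)
  open import Relation.Binary.Reasoning.Setoid setoid

  ⟦_⟧ℤ : ℤ → Carrier
  ⟦ + n ⟧ℤ      = n ×ₙ 1#
  ⟦ -[1+ n ] ⟧ℤ = - (suc n ×ₙ 1#)

  private
    signed : Sign → Carrier → Carrier
    signed Sign.+ x = x
    signed Sign.- x = - x

    signed-cong : ∀ s {x y} → x ≈ y → signed s x ≈ signed s y
    signed-cong Sign.+ p = p
    signed-cong Sign.- p = -‿cong p

    signed-* : ∀ s t x y → signed (s Sign.* t) (x * y) ≈ signed s x * signed t y
    signed-* Sign.+ Sign.+ x y = refl
    signed-* Sign.+ Sign.- x y = -‿distribʳ-* x y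
    signed-* Sign.- Sign.+ x y = -‿distribˡ-* x y
    signed-* Sign.- Sign.- x y = begin
      x * y         ≈⟨ -‿involutive (x * y) ⟨
      - - (x * y)   ≈⟨ -‿cong (-‿distribʳ-* x y) ⟩
      - (x * - y)   ≈⟨ -‿distribˡ-* x (- y) ⟩
      - x * - y     ∎

    ⟦◃⟧ : ∀ s n → ⟦ s ℤ.◃ n ⟧ℤ ≈ signed s (n ×ₙ 1#)
    ⟦◃⟧ Sign.+ zero    = refl
    ⟦◃⟧ Sign.- zero    = sym -0#≈0#
    ⟦◃⟧ Sign.+ (suc n) = refl
    ⟦◃⟧ Sign.- (suc n) = refl

    ⟦sign◃abs⟧ : ∀ i → ⟦ i ⟧ℤ ≈ signed (ℤ.sign i) (ℤ.∣ i ∣ ×ₙ 1#)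
    ⟦sign◃abs⟧ (+ n)    = refl
    ⟦sign◃abs⟧ -[1+ n ] = refl

    1+x-1+y : ∀ x y → (1# + x) - (1# + y) ≈ x - y
    1+x-1+y x y = begin
      (1# + x) - (1# + y)    ≈⟨ +-congˡ (-‿+-comm 1# y) ⟨
      (1# + x) + (- 1# - y)  ≈⟨ +-congʳ (+-comm 1# x) ⟩
      (x + 1#) + (- 1# - y)  ≈⟨ +-assoc x 1# _ ⟩
      x + (1# + (- 1# - y))  ≈⟨ +-congˡ (+-assoc 1# (- 1#) (- y)) ⟨
      x + ((1# - 1#) - y)    ≈⟨ +-congˡ (+-congʳ (-‿inverseʳ 1#)) ⟩
      x + (0# - y)           ≈⟨ +-congˡ (+-identityˡ (- y)) ⟩
      x - y                  ∎

    ⟦⊖⟧ : ∀ m n → ⟦ m ℤ.⊖ n ⟧ℤ ≈ m ×ₙ 1# - n ×ₙ 1#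
    ⟦⊖⟧ zero    zero    = sym (-‿inverseʳ 0#)
    ⟦⊖⟧ zero    (suc n) = sym (+-identityˡ _)
    ⟦⊖⟧ (suc m) zero    = sym (trans (+-congˡ -0#≈0#) (+-identityʳ _))
    ⟦⊖⟧ (suc m) (suc n) = begin
      ⟦ suc m ℤ.⊖ suc n ⟧ℤ            ≡⟨ ≡.cong ⟦_⟧ℤ (ℤₚ.[1+m]⊖[1+n]≡m⊖n m n) ⟩
      ⟦ m ℤ.⊖ n ⟧ℤ                    ≈⟨ ⟦⊖⟧ m n ⟩
      m ×ₙ 1# - n ×ₙ 1#               ≈⟨ 1+x-1+y _ _ ⟨
      (1# + m ×ₙ 1#) - (1# + n ×ₙ 1#) ≈⟨ +-cong (1+× m 1#) (-‿cong (1+× n 1#)) ⟨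
      suc m ×ₙ 1# - suc n ×ₙ 1#       ∎

    ⟦+⟧ : ∀ i j → ⟦ i ℤ.+ j ⟧ℤ ≈ ⟦ i ⟧ℤ + ⟦ j ⟧ℤ
    ⟦+⟧ (+ m)    (+ n)    = ×-homo-+ 1# m n
    ⟦+⟧ (+ m)    -[1+ n ] = ⟦⊖⟧ m (suc n)
    ⟦+⟧ -[1+ m ] (+ n)    = trans (⟦⊖⟧ n (suc m)) (+-comm _ _)
    ⟦+⟧ -[1+ m ] -[1+ n ] = begin
      - (suc (suc (m ℕ.+ n)) ×ₙ 1#)      ≡⟨ ≡.cong (λ k → - (suc k ×ₙ 1#)) (ℕₚ.+-suc m n) ⟨
      - (suc (m ℕ.+ suc n) ×ₙ 1#)        ≈⟨ -‿cong (×-homo-+ 1# (suc m) (suc n)) ⟩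
      - (suc m ×ₙ 1# + suc n ×ₙ 1#)      ≈⟨ -‿+-comm _ _ ⟨
      - (suc m ×ₙ 1#) - (suc n ×ₙ 1#)    ∎

    ⟦*⟧ : ∀ i j → ⟦ i ℤ.* j ⟧ℤ ≈ ⟦ i ⟧ℤ * ⟦ j ⟧ℤ
    ⟦*⟧ i j = begin
      ⟦ i ℤ.* j ⟧ℤ                                    ≈⟨ ⟦◃⟧ (s Sign.* t) (ℤ.∣ i ∣ ℕ.* ℤ.∣ j ∣) ⟩
      signed (s Sign.* t) ((ℤ.∣ i ∣ ℕ.* ℤ.∣ j ∣) ×ₙ 1#) ≈⟨ signed-cong (s Sign.* t) (×1-homo-* ℤ.∣ i ∣ ℤ.∣ j ∣) ⟩
      signed (s Sign.* t) (∣i∣ * ∣j∣)                  ≈⟨ signed-* s t ∣i∣ ∣j∣ ⟩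
      signed s ∣i∣ * signed t ∣j∣                      ≈⟨ *-cong (⟦sign◃abs⟧ i) (⟦sign◃abs⟧ j) ⟨
      ⟦ i ⟧ℤ * ⟦ j ⟧ℤ                                  ∎
      where
      s = ℤ.sign i
      t = ℤ.sign j
      ∣i∣ = ℤ.∣ i ∣ ×ₙ 1#
      ∣j∣ = ℤ.∣ j ∣ ×ₙ 1#

    ⟦-⟧ : ∀ i → ⟦ ℤ.- i ⟧ℤ ≈ - ⟦ i ⟧ℤ
    ⟦-⟧ (+ zero)  = sym -0#≈0#
    ⟦-⟧ (+ suc n) = refl
    ⟦-⟧ -[1+ n ]  = sym (-‿involutive _)

    ℤ-rawRing : RawRing 0ℓ 0ℓ
    ℤ-rawRing = record
      { Carrier = ℤ ; _≈_ = _≡_ ; _+_ = ℤ._+_ ; _*_ = ℤ._*_ ; -_ = ℤ.-_ ; 0# = + 0 ; 1# = + 1 }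

    ⟦⟧ℤ-homomorphism : ℤ-rawRing -Raw-AlmostCommutative⟶ fromCommutativeRing R
    ⟦⟧ℤ-homomorphism = record
      { ⟦_⟧ = ⟦_⟧ℤ ; +-homo = ⟦+⟧ ; *-homo = ⟦*⟧ ; -‿homo = ⟦-⟧ ; 0-homo = refl ; 1-homo = refl }

    ⟦⟧ℤ-≟ : ∀ i j → Maybe (⟦ i ⟧ℤ ≈ ⟦ j ⟧ℤ)
    ⟦⟧ℤ-≟ i j with i ℤ.≟ j
    ... | yes ≡.refl = just refl
    ... | no _       = nothing

  open RingSolver ℤ-rawRing (fromCommutativeRing R) ⟦⟧ℤ-homomorphism ⟦⟧ℤ-≟ public
    using (solve; _:+_; _:*_; :-_; _:-_; con; _:=_)

module _ {a ℓ} (S : Setoid a ℓ) where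
  open Setoid S renaming (Carrier to A)

  record Card {p} (P : Pred A p) (n : ℕ) : Set (a ⊔ ℓ ⊔ p) where
    field
      elem       : Fin n → A
      elem∈      : ∀ i → P (elem i)
      elem-inj   : ∀ {i j} → elem i ≈ elem j → i ≡ j
      elem-cover : ∀ {x} → P x → ∃[ i ] elem i ≈ x

open Card

card-Fin-subset : ∀ {p m} {P : Pred (Fin m) p} → Decidable₁ P → ∃[ n ] Card (≡.setoid (Fin m)) P n
card-Fin-subset {m = zero} P? =
  0 , record { elem = λ () ; elem∈ = λ () ; elem-inj = λ {} ; elem-cover = λ {i} _ → ⊥-elim (Finₚ.¬Fin0 i) }
card-Fin-subset {m = suc m} {P} P? with card-Fin-subset (P? ∘ suc) | P? zero
... | n , c | no ¬P0 = n , record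
  { elem = suc ∘ elem c ; elem∈ = elem∈ c ; elem-inj = elem-inj c ∘ Finₚ.suc-injective ; elem-cover = cover }
  where
  cover : ∀ {k} → P k → ∃[ i ] suc (elem c i) ≡ k
  cover {zero}  P0 = ⊥-elim (¬P0 P0)
  cover {suc k} Pk = Prod.map₂ (≡.cong suc) (elem-cover c Pk)
... | n , c | yes P0 = suc n , record { elem = el ; elem∈ = el∈ ; elem-inj = el-inj ; elem-cover = cover }
  where
  el : Fin (suc n) → Fin (suc m)
  el zero    = zero
  el (suc i) = suc (elem c i)
  el∈ : ∀ i → P (el i)
  el∈ zero    = P0
  el∈ (suc i) = elem∈ c i
  el-inj : ∀ {i j} → el i ≡ el j → i ≡ j
  el-inj {zero}  {zero}  _  = ≡.refl
  el-inj {suc i} {suc j} eq = ≡.cong suc (elem-inj c (Finₚ.suc-injective eq))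
  cover : ∀ {k} → P k → ∃[ i ] el i ≡ k
  cover {zero}  _  = zero , ≡.refl
  cover {suc k} Pk = Prod.map suc (≡.cong suc) (elem-cover c Pk)

module _ {a ℓ} {S : Setoid a ℓ} where
  open Setoid S renaming (Carrier to A)

  module _ {p q} {P : Pred A p} {Q : Pred A q} where

    card-≤ : ∀ {m n} → Card S P m → Card S Q n → P ⊆ Q → m ℕ.≤ n
    card-≤ cP cQ P⊆Q = Finₚ.injective⇒≤ inj
      where
      f : Fin _ → Fin _
      f i = proj₁ (elem-cover cQ (P⊆Q (elem∈ cP i)))
      inj : ∀ {i j} → f i ≡ f j → i ≡ j
      inj {i} {j} fi≡fj = elem-inj cP (begin
        elem cP i        ≈⟨ proj₂ (elem-cover cQ (P⊆Q (elem∈ cP i))) ⟨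
        elem cQ (f i)    ≡⟨ ≡.cong (elem cQ) fi≡fj ⟩
        elem cQ (f j)    ≈⟨ proj₂ (elem-cover cQ (P⊆Q (elem∈ cP j))) ⟩
        elem cP j        ∎)
        where open import Relation.Binary.Reasoning.Setoid S

    card-cong : ∀ {n} → P ≐ Q → Card S P n → Card S Q n
    card-cong (P⊆Q , Q⊆P) c = record
      { elem = elem c ; elem∈ = P⊆Q ∘ elem∈ c ; elem-inj = elem-inj c ; elem-cover = elem-cover c ∘ Q⊆P }

    card-∪ : ∀ {m n} → Q Respects _≈_ → (∀ {x} → P x → ¬ Q x) →
             Card S P m → Card S Q n → Card S (P ∪ Q) (m ℕ.+ n)
    card-∪ {m} {n} resp disjoint cP cQ = record
      { elem = el ; elem∈ = el∈ ; elem-inj = el-inj ; elem-cover = cover }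
      where
      el⊎ : Fin m ⊎ Fin n → A
      el⊎ = [ elem cP , elem cQ ]′
      el : Fin (m ℕ.+ n) → A
      el = el⊎ ∘ splitAt m
      el∈ : ∀ i → (P ∪ Q) (el i)
      el∈ i with splitAt m i
      ... | inj₁ k = inj₁ (elem∈ cP k)
      ... | inj₂ k = inj₂ (elem∈ cQ k)
      el⊎-inj : ∀ u v → el⊎ u ≈ el⊎ v → u ≡ v
      el⊎-inj (inj₁ k) (inj₁ l) eq = ≡.cong inj₁ (elem-inj cP eq)
      el⊎-inj (inj₁ k) (inj₂ l) eq = ⊥-elim (disjoint (elem∈ cP k) (resp (sym eq) (elem∈ cQ l)))
      el⊎-inj (inj₂ k) (inj₁ l) eq = ⊥-elim (disjoint (elem∈ cP l) (resp eq (elem∈ cQ k)))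
      el⊎-inj (inj₂ k) (inj₂ l) eq = ≡.cong inj₂ (elem-inj cQ eq)
      el-inj : ∀ {i j} → el i ≈ el j → i ≡ j
      el-inj {i} {j} eq = begin
        i                         ≡⟨ Finₚ.join-splitAt m n i ⟨
        join m n (splitAt m i)    ≡⟨ ≡.cong (join m n) (el⊎-inj (splitAt m i) (splitAt m j) eq) ⟩
        join m n (splitAt m j)    ≡⟨ Finₚ.join-splitAt m n j ⟩
        j                         ∎
        where open ≡.≡-Reasoning
      cover : ∀ {x} → (P ∪ Q) x → ∃[ i ] el i ≈ x
      cover (inj₁ Px) with elem-cover cP Px
      ... | k , eq = k ↑ˡ n , ≡.subst (λ u → el⊎ u ≈ _) (≡.sym (Finₚ.splitAt-↑ˡ m k n)) eq
      cover (inj₂ Qx) with elem-cover cQ Qx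
      ... | k , eq = m ↑ʳ k , ≡.subst (λ u → el⊎ u ≈ _) (≡.sym (Finₚ.splitAt-↑ʳ m n k)) eq

  card-unique : ∀ {p q} {P : Pred A p} {Q : Pred A q} {m n} → P ≐ Q → Card S P m → Card S Q n → m ≡ n
  card-unique (P⊆Q , Q⊆P) cP cQ = ℕₚ.≤-antisym (card-≤ cP cQ P⊆Q) (card-≤ cQ cP Q⊆P)

  card-filter : ∀ {p q} {P : Pred A p} {Q : Pred A q} {m} → P Respects _≈_ → Decidable₁ P →
                Card S Q m → ∃[ n ] Card S (Q ∩ P) n
  card-filter {P = P} {Q = Q} resp P? cQ with card-Fin-subset (P? ∘ elem cQ)
  ... | n , c = n , record
    { elem       = elem cQ ∘ elem c
    ; elem∈      = λ i → elem∈ cQ (elem c i) , elem∈ c i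
    ; elem-inj   = elem-inj c ∘ elem-inj cQ
    ; elem-cover = cover
    }
    where
    cover : ∀ {x} → (Q ∩ P) x → ∃[ i ] elem cQ (elem c i) ≈ x
    cover (Qx , Px) with elem-cover cQ Qx
    ... | k , eq with elem-cover c (resp (sym eq) Px)
    ... | i , ≡.refl = i , eq

  ∁-respects : ∀ {p} {P : Pred A p} → P Respects _≈_ → ∁ P Respects _≈_
  ∁-respects resp x≈y ¬Px = ¬Px ∘ resp (sym x≈y)

  card-complement : ∀ {p} {P : Pred A p} {m M} → P Respects _≈_ → Decidable₁ P →
                    Card S U M → Card S P m → ∃[ n ] Card S (∁ P) n × m ℕ.+ n ≡ M
  card-complement {P = P} resp P? cU cP with card-filter (∁-respects resp) (¬? ∘ P?) cU
  ... | n , c∁P = n , c∁P′ , card-unique P∪∁P≐U (card-∪ (∁-respects resp) (λ Px ¬Px → ¬Px Px) cP c∁P′) cU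
    where
    c∁P′ : Card S (∁ P) n
    c∁P′ = card-cong (proj₂ , (tt ,_)) c∁P
    P∪∁P≐U : (P ∪ ∁ P) ≐ U
    P∪∁P≐U = (λ _ → tt) , λ {x} _ → toSum (P? x)

  card-⊆⇒⊇ : ∀ {p q} {P : Pred A p} {Q : Pred A q} {n} → P Respects _≈_ → Q Respects _≈_ → Decidable₁ P →
             P ⊆ Q → Card S P n → Card S Q n → Q ⊆ P
  card-⊆⇒⊇ {P = P} {Q} {n} respP respQ P? P⊆Q cP cQ {x} Qx with P? x
  ... | yes Px = Px
  ... | no ¬Px with card-filter (∁-respects respP) (¬? ∘ P?) cQ
  ... | k , cQ∖P = ⊥-elim (Finₚ.¬Fin0 (≡.subst Fin k≡0 (proj₁ (elem-cover cQ∖P (Qx , ¬Px)))))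
    where
    split : (P ∪ (Q ∩ ∁ P)) ≐ Q
    split = [ P⊆Q , proj₁ ]′ , λ {y} Qy → Sum.map₂ (Qy ,_) (toSum (P? y))
    k≡0 : k ≡ 0
    k≡0 = ℕₚ.+-cancelˡ-≡ n k 0 (≡.trans (card-unique split
      (card-∪ (λ x≈y → Prod.map (respQ x≈y) (∁-respects respP x≈y)) (λ Py → (_$ Py) ∘ proj₂) cP cQ∖P) cQ)
      (≡.sym (ℕₚ.+-identityʳ n)))

module _ {a b ℓ ℓ′} {S : Setoid a ℓ} {T : Setoid b ℓ′} where
  private
    module S = Setoid S
    module T = Setoid T

  card-map : ∀ {p q} {P : Pred S.Carrier p} {Q : Pred T.Carrier q} {n} (f : S.Carrier → T.Carrier) →
             (∀ {x y} → x S.≈ y → f x T.≈ f y) → (∀ {x} → P x → Q (f x)) →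
             (∀ {x y} → P x → P y → f x T.≈ f y → x S.≈ y) → (∀ {y} → Q y → ∃[ x ] P x × f x T.≈ y) →
             Card S P n → Card T Q n
  card-map f f-cong f∈ f-inj f-onto cP = record
    { elem       = f ∘ elem cP
    ; elem∈      = f∈ ∘ elem∈ cP
    ; elem-inj   = λ {i} {j} eq → elem-inj cP (f-inj (elem∈ cP i) (elem∈ cP j) eq)
    ; elem-cover = cover
    }
    where
    cover : ∀ {y} → _ → ∃[ i ] f (elem cP i) T.≈ y
    cover Qy with f-onto Qy
    ... | x , Px , fx≈y with elem-cover cP Px
    ... | i , eq = i , T.trans (f-cong eq) fx≈y

  card-× : ∀ {p q} {P : Pred S.Carrier p} {Q : Pred T.Carrier q} {m n} →
           Card S P m → Card T Q n → Card (×-setoid S T) (P ⟨×⟩ Q) (m ℕ.* n)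
  card-× {P = P} {Q} {m} {n} cP cQ = record
    { elem       = el
    ; elem∈      = λ i → elem∈ cP (proj₁ (remQuot {m} n i)) , elem∈ cQ (proj₂ (remQuot {m} n i))
    ; elem-inj   = el-inj
    ; elem-cover = cover
    }
    where
    el : Fin (m ℕ.* n) → S.Carrier × T.Carrier
    el = Prod.map (elem cP) (elem cQ) ∘ remQuot {m} n
    el-inj : ∀ {i j} → Setoid._≈_ (×-setoid S T) (el i) (el j) → i ≡ j
    el-inj {i} {j} (eq₁ , eq₂) = begin
      i                                       ≡⟨ Finₚ.combine-remQuot {m} n i ⟨
      Prod.uncurry combine (remQuot {m} n i)  ≡⟨ ≡.cong₂ combine (elem-inj cP eq₁) (elem-inj cQ eq₂) ⟩
      Prod.uncurry combine (remQuot {m} n j)  ≡⟨ Finₚ.combine-remQuot {m} n j ⟩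
      j                                       ∎
      where open ≡.≡-Reasoning
    cover : ∀ {xy} → (P ⟨×⟩ Q) xy → ∃[ i ] Setoid._≈_ (×-setoid S T) (el i) xy
    cover (Px , Qy) with elem-cover cP Px | elem-cover cQ Qy
    ... | k , eq₁ | l , eq₂ = combine k l , ≡.subst (λ kl → Setoid._≈_ (×-setoid S T) (Prod.map (elem cP) (elem cQ) kl) _)
                                                   (≡.sym (Finₚ.remQuot-combine {m} {n} k l)) (eq₁ , eq₂)

card-Fin : ∀ n → Card (≡.setoid (Fin n)) U n
card-Fin n = record { elem = id ; elem∈ = _ ; elem-inj = id ; elem-cover = λ {i} _ → i , ≡.refl }

module _ {a ℓ} (S : Setoid a ℓ) where
  open Setoid S
  open VecEq S using (≋-setoid)

  card-→ : ∀ {m} → Card S U m → ∀ n → Card (≋-setoid n) U (m ℕ.^ n)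
  card-→ cS zero = record
    { elem = λ _ () ; elem∈ = _ ; elem-inj = λ { {zero} {zero} _ → ≡.refl } ; elem-cover = λ _ → zero , λ () }
  card-→ cS (suc n) =
    card-map cons cons-cong _ (λ _ _ eq → eq zero , eq ∘ suc) (λ {f} _ → (f zero , f ∘ suc) , (tt , tt) , cons-split f)
      (card-× cS (card-→ cS n))
    where
    cons : Carrier × (Fin n → Carrier) → Fin (suc n) → Carrier
    cons (x , f) zero    = x
    cons (x , f) (suc i) = f i
    cons-cong : ∀ {u v} → Setoid._≈_ (×-setoid S (≋-setoid n)) u v → ∀ i → cons u i ≈ cons v i
    cons-cong (eq , _)  zero    = eq
    cons-cong (_ , eqs) (suc i) = eqs i
    cons-split : ∀ f i → cons (f zero , f ∘ suc) i ≈ f i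
    cons-split f zero    = refl
    cons-split f (suc i) = refl

module LocalRing {c ℓ} (K : CommutativeRing c ℓ) (r : CommutativeRing.Carrier K)
                 (ideals : ExactlyThreeIdeals K r) where
  open CommutativeRing K
  open IntegerSolver K
  open import Relation.Binary.Reasoning.Setoid setoid

  J : Pred Carrier (c ⊔ ℓ)
  J = PrincipalIdeal K r

  Unit : Pred Carrier (c ⊔ ℓ)
  Unit = IsUnit K

  private
    Multiples : Carrier → Pred Carrier (c ⊔ ℓ)
    Multiples x = PrincipalIdeal K x

    multiples-isIdeal : ∀ x → IsIdeal K (Multiples x)
    multiples-isIdeal x = record
      { resp  = λ { y≈z (u , y≈ux) → u , trans (sym y≈z) y≈ux }
      ; zero∈ = 0# , sym (zeroˡ x)
      ; +-cl  = λ { (u , y≈) (v , z≈) → u + v , trans (+-cong y≈ z≈) (sym (distribʳ x u v)) }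
      ; *-cl  = λ { k (u , y≈) → k * u , trans (*-congˡ y≈) (sym (*-assoc k u x)) }
      }

    x∈⟨x⟩ : ∀ x → Multiples x x
    x∈⟨x⟩ x = 1# , sym (*-identityˡ x)

    classify : ∀ x → (Multiples x ≐ ZeroIdeal K) ⊎ (Multiples x ≐ J) ⊎ (Multiples x ≐ FullIdeal K)
    classify x = proj₁ ideals (Multiples x) (multiples-isIdeal x)

  J-resp : J Respects _≈_
  J-resp x≈y (u , x≈ur) = u , trans (sym x≈y) x≈ur

  J-*r : ∀ x → J (x * r)
  J-*r x = x , refl

  J-r : J r
  J-r = 1# , sym (*-identityˡ r)

  J-+ : ∀ {x y} → J x → J y → J (x + y)
  J-+ (u , x≈) (v , y≈) = u + v , trans (+-cong x≈ y≈) (sym (distribʳ r u v))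

  J-*ˡ : ∀ k {x} → J x → J (k * x)
  J-*ˡ k (u , x≈) = k * u , trans (*-congˡ x≈) (sym (*-assoc k u r))

  J-*ʳ : ∀ k {x} → J x → J (x * k)
  J-*ʳ k Jx = J-resp (*-comm k _) (J-*ˡ k Jx)

  J-neg : ∀ {x} → J x → J (- x)
  J-neg (u , x≈) = - u , trans (-‿cong x≈) (solve 2 (λ u r → :- (u :* r) := (:- u) :* r) refl u r)

  J-sub : ∀ {x y} → J x → J y → J (x - y)
  J-sub Jx Jy = J-+ Jx (J-neg Jy)

  Unit-resp : Unit Respects _≈_
  Unit-resp x≈y (u , xu≈1) = u , trans (*-congʳ (sym x≈y)) xu≈1

  Unit-1 : Unit 1#
  Unit-1 = 1# , *-identityˡ 1#

  Unit-* : ∀ {x y} → Unit x → Unit y → Unit (x * y)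
  Unit-* {x} {y} (u , xu≈1) (v , yv≈1) = u * v , (begin
    (x * y) * (u * v)  ≈⟨ solve 4 (λ x y u v → (x :* y) :* (u :* v) := (x :* u) :* (y :* v)) refl x y u v ⟩
    (x * u) * (y * v)  ≈⟨ *-cong xu≈1 yv≈1 ⟩
    1# * 1#            ≈⟨ *-identityˡ 1# ⟩
    1#                 ∎)

  Unit-inverse : ∀ {x} (x-unit : Unit x) → Unit (proj₁ x-unit)
  Unit-inverse {x} (u , xu≈1) = x , trans (*-comm u x) xu≈1

  Unit-*⇒Unitʳ : ∀ {u x} → Unit (u * x) → Unit x
  Unit-*⇒Unitʳ {u} {x} (w , uxw≈1) = u * w , trans (solve 3 (λ x u w → x :* (u :* w) := (u :* x) :* w) refl x u w) uxw≈1

  x*u≈0⇒x≈0 : ∀ {u x} → Unit u → x * u ≈ 0# → x ≈ 0#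
  x*u≈0⇒x≈0 {u} {x} (v , uv≈1) xu≈0 = begin
    x              ≈⟨ *-identityʳ x ⟨
    x * 1#         ≈⟨ *-congˡ uv≈1 ⟨
    x * (u * v)    ≈⟨ *-assoc x u v ⟨
    (x * u) * v    ≈⟨ *-congʳ xu≈0 ⟩
    0# * v         ≈⟨ zeroˡ v ⟩
    0#             ∎

  r≉0 : ¬ r ≈ 0#
  r≉0 r≈0 = proj₁ (proj₂ ideals)
    ( (λ { (u , x≈ur) → trans x≈ur (trans (*-congˡ r≈0) (zeroʳ u)) })
    , (λ x≈0 → 0# , trans x≈0 (sym (zeroˡ r))) )

  r-nonunit : ¬ Unit r
  r-nonunit (s , rs≈1) = proj₂ (proj₂ ideals) ((λ _ → _) , λ {x} _ → x * s , (begin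
    x              ≈⟨ *-identityʳ x ⟨
    x * 1#         ≈⟨ *-congˡ rs≈1 ⟨
    x * (r * s)    ≈⟨ solve 3 (λ x r s → x :* (r :* s) := (x :* s) :* r) refl x r s ⟩
    (x * s) * r    ∎))

  unit∉J : ∀ {x} → Unit x → ¬ J x
  unit∉J {x} (u , xu≈1) (y , x≈yr) = r-nonunit (y * u , (begin
    r * (y * u)    ≈⟨ solve 3 (λ r y u → r :* (y :* u) := (y :* r) :* u) refl r y u ⟩
    (y * r) * u    ≈⟨ *-congʳ x≈yr ⟨
    x * u          ≈⟨ xu≈1 ⟩
    1#             ∎))

  unit⊎J : ∀ x → Unit x ⊎ J x
  unit⊎J x with classify x
  ... | inj₁ (⟨x⟩⊆0 , _)        = inj₂ (0# , trans (⟨x⟩⊆0 (x∈⟨x⟩ x)) (sym (zeroˡ r)))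
  ... | inj₂ (inj₁ (⟨x⟩⊆J , _)) = inj₂ (⟨x⟩⊆J (x∈⟨x⟩ x))
  ... | inj₂ (inj₂ (_ , K⊆⟨x⟩)) with K⊆⟨x⟩ {1#} _
  ...   | y , 1≈yx = inj₁ (y , trans (*-comm x y) (sym 1≈yx))

  Unit? : Decidable₁ Unit
  Unit? x = Sum.[ yes , (λ Jx → no (λ ux → unit∉J ux Jx)) ]′ (unit⊎J x)

  J? : Decidable₁ J
  J? x = Sum.[ (λ ux → no (unit∉J ux)) , yes ]′ (unit⊎J x)

  ¬J⇒Unit : ∀ {x} → ¬ J x → Unit x
  ¬J⇒Unit {x} ¬Jx = Sum.[ (λ ux → ux) , (λ Jx → ⊥-elim (¬Jx Jx)) ]′ (unit⊎J x)

  Unit-+J : ∀ {x y} → Unit x → J y → Unit (x + y)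
  Unit-+J {x} {y} ux Jy = ¬J⇒Unit λ Jx+y →
    unit∉J ux (J-resp (solve 2 (λ x y → (x :+ y) :- y := x) refl x y) (J-sub Jx+y Jy))

  -- ⟨r²⟩ cannot be J: then r = y r², and r (1 − y r) = 0 with 1 − y r a unit.
  r*r≈0 : r * r ≈ 0#
  r*r≈0 with classify (r * r)
  ... | inj₁ (⟨r²⟩⊆0 , _) = ⟨r²⟩⊆0 (x∈⟨x⟩ (r * r))
  ... | inj₂ (inj₂ (_ , K⊆⟨r²⟩)) with K⊆⟨r²⟩ {1#} _
  ...   | y , 1≈yr² = ⊥-elim (r-nonunit (r * y , trans (solve 2 (λ r y → r :* (r :* y) := y :* (r :* r)) refl r y) (sym 1≈yr²)))
  r*r≈0 | inj₂ (inj₁ (_ , J⊆⟨r²⟩)) with J⊆⟨r²⟩ J-r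
  ... | y , r≈yr² = ⊥-elim (r≉0 (x*u≈0⇒x≈0 1-yr-unit (begin
    r * (1# - y * r)       ≈⟨ solve 3 (λ r y o → r :* (o :- y :* r) := r :* o :- y :* (r :* r)) refl r y 1# ⟩
    r * 1# - y * (r * r)   ≈⟨ +-cong (*-identityʳ r) (-‿cong (sym r≈yr²)) ⟩
    r - r                  ≈⟨ -‿inverseʳ r ⟩
    0#                     ∎)))
    where
    1-yr-unit : Unit (1# - y * r)
    1-yr-unit = Unit-+J Unit-1 (J-neg (J-*r y))

  J*J≈0 : ∀ {x y} → J x → J y → x * y ≈ 0#
  J*J≈0 {x} {y} (u , x≈ur) (v , y≈vr) = begin
    x * y              ≈⟨ *-cong x≈ur y≈vr ⟩
    (u * r) * (v * r)  ≈⟨ solve 3 (λ u v r → (u :* r) :* (v :* r) := (u :* v) :* (r :* r)) refl u v r ⟩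
    (u * v) * (r * r)  ≈⟨ *-congˡ r*r≈0 ⟩
    (u * v) * 0#       ≈⟨ zeroʳ _ ⟩
    0#                 ∎

  r*J≈0 : ∀ {x} → J x → r * x ≈ 0#
  r*J≈0 = J*J≈0 J-r

  *r≈0⇒J : ∀ {x} → x * r ≈ 0# → J x
  *r≈0⇒J {x} xr≈0 = Sum.[ (λ ux → ⊥-elim (r≉0 (x*u≈0⇒x≈0 ux (trans (*-comm r x) xr≈0)))) , (λ Jx → Jx) ]′ (unit⊎J x)

module ResidueCounts {c ℓ} (K : CommutativeRing c ℓ) (r : CommutativeRing.Carrier K)
                     (ideals : ExactlyThreeIdeals K r) (q : ℕ) (residues : ResidueFieldSize K r q) where
  open CommutativeRing K
  open IntegerSolver K
  open LocalRing K r ideals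
  open import Relation.Binary.Reasoning.Setoid setoid

  t : Fin q → Carrier
  t = proj₁ residues

  t-inj : ∀ {i j} → J (t i - t j) → i ≡ j
  t-inj = proj₁ (proj₂ residues) _ _

  t-cover : ∀ x → ∃[ i ] J (x - t i)
  t-cover = proj₂ (proj₂ residues)

  *r-residue : ∀ y → ∃[ j ] y * r ≈ t j * r
  *r-residue y with t-cover y
  ... | j , y-tj∈J = j , (begin
    y * r                       ≈⟨ *-congʳ (solve 2 (λ y t → y := t :+ (y :- t)) refl y (t j)) ⟩
    (t j + (y - t j)) * r       ≈⟨ distribʳ r (t j) (y - t j) ⟩
    t j * r + (y - t j) * r     ≈⟨ +-congˡ (J*J≈0 y-tj∈J J-r) ⟩
    t j * r + 0#                ≈⟨ +-identityʳ _ ⟩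
    t j * r                     ∎)

  t*r-inj : ∀ {i j} → t i * r ≈ t j * r → i ≡ j
  t*r-inj {i} {j} eq = t-inj (*r≈0⇒J (begin
    (t i - t j) * r             ≈⟨ solve 3 (λ a b r → (a :- b) :* r := a :* r :- b :* r) refl (t i) (t j) r ⟩
    t i * r - t j * r           ≈⟨ +-congʳ eq ⟩
    t j * r - t j * r           ≈⟨ -‿inverseʳ _ ⟩
    0#                          ∎))

  -- x ↦ x r identifies K/J with J, so every element is t i + r t j for unique i and j.
  digits : Fin q × Fin q → Carrier
  digits (i , j) = t i + r * t j

  digits-inj : ∀ {i j i′ j′} → digits (i , j) ≈ digits (i′ , j′) → i ≡ i′ × j ≡ j′
  digits-inj {i} {j} {i′} {j′} eq with t-inj {i} {i′} (J-resp (begin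
      (t j′ - t j) * r
        ≈⟨ solve 5 (λ a b c d r → (d :- b) :* r := (c :+ r :* d) :- c :- r :* b) refl (t i) (t j) (t i′) (t j′) r ⟩
      digits (i′ , j′) - t i′ - r * t j ≈⟨ +-congʳ (+-congʳ eq) ⟨
      digits (i , j) - t i′ - r * t j   ≈⟨ solve 4 (λ a b c r → (a :+ r :* b) :- c :- r :* b := a :- c) refl (t i) (t j) (t i′) r ⟩
      t i - t i′                        ∎) (J-*r (t j′ - t j)))
  ... | ≡.refl = ≡.refl , t*r-inj (begin
      t j * r                           ≈⟨ solve 3 (λ a b r → b :* r := (a :+ r :* b) :- a) refl (t i) (t j) r ⟩
      digits (i , j) - t i              ≈⟨ +-congʳ eq ⟩
      digits (i , j′) - t i             ≈⟨ solve 3 (λ a b r → (a :+ r :* b) :- a := b :* r) refl (t i) (t j′) r ⟩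
      t j′ * r                          ∎)

  digits-onto : ∀ x → ∃[ ij ] digits ij ≈ x
  digits-onto x with t-cover x
  ... | i , (y , x-ti≈yr) with *r-residue y
  ...   | j , yr≈tjr = (i , j) , (begin
    t i + r * t j           ≈⟨ +-congˡ (trans (*-comm r (t j)) (sym yr≈tjr)) ⟩
    t i + y * r             ≈⟨ +-congˡ x-ti≈yr ⟨
    t i + (x - t i)         ≈⟨ solve 2 (λ a x → a :+ (x :- a) := x) refl (t i) x ⟩
    x                       ∎)

  card-K : Card setoid U (q ℕ.* q)
  card-K = card-map digits (λ { (≡.refl , ≡.refl) → refl }) _ (λ _ _ → digits-inj)
    (λ {x} _ → proj₁ (digits-onto x) , _ , proj₂ (digits-onto x))
    (card-× (card-Fin q) (card-Fin q))

  card-J : Card setoid J q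
  card-J = card-map (λ j → t j * r) (λ { ≡.refl → refl }) (λ {j} _ → J-*r (t j)) (λ _ _ → t*r-inj) onto (card-Fin q)
    where
    onto : ∀ {x} → J x → ∃[ j ] _ × t j * r ≈ x
    onto (y , x≈yr) = proj₁ (*r-residue y) , _ , trans (sym (proj₂ (*r-residue y))) (sym x≈yr)

  card-Unit : ∃[ n ] Card setoid Unit n × q ℕ.+ n ≡ q ℕ.* q
  card-Unit = Prod.map₂ (Prod.map₁ (card-cong ∁J≐Unit)) (card-complement J-resp J? card-K card-J)
    where
    ∁J≐Unit : ∁ J ≐ Unit
    ∁J≐Unit = ¬J⇒Unit , unit∉J

  card-nonzero : Decidable _≈_ → ∃[ n ] Card setoid (∁ (_≈ 0#)) n × 1 ℕ.+ n ≡ q ℕ.* q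
  card-nonzero _≟_ = card-complement (λ x≈y x≈0 → trans (sym x≈y) x≈0) (_≟ 0#) card-K card-0
    where
    card-0 : Card setoid (_≈ 0#) 1
    card-0 = record
      { elem = λ _ → 0# ; elem∈ = λ _ → refl ; elem-inj = λ { {Fin.zero} {Fin.zero} _ → ≡.refl }
      ; elem-cover = λ x≈0 → Fin.zero , sym x≈0 }

module SymplecticForm {c ℓ} (K : CommutativeRing c ℓ) (e : ℕ) where
  open CommutativeRing K
  open IntegerSolver K
  open import Algebra.Properties.Semiring.Sum semiring
    using (sum; sum-cong-≋; ∑-distrib-+; *-distribˡ-sum; sum-remove; sum-replicate-zero)
  open import Relation.Binary.Reasoning.Setoid setoid

  V : Set c
  V = Vect K e

  infix  4 _≈ᵥ_
  infixl 6 _+ᵥ_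
  infixr 7 _·ᵥ_

  _≈ᵥ_ : V → V → Set ℓ
  _≈ᵥ_ = Defs._≈ᵥ_ K

  _+ᵥ_ : V → V → V
  _+ᵥ_ = Defs._+ᵥ_ K

  _·ᵥ_ : Carrier → V → V
  _·ᵥ_ = Defs._·ᵥ_ K

  V-setoid : Setoid c ℓ
  V-setoid = record
    { Carrier = V ; _≈_ = _≈ᵥ_
    ; isEquivalence = record { refl = λ _ → refl ; sym = λ eq j → sym (eq j) ; trans = λ eq eq′ j → trans (eq j) (eq′ j) } }

  ⟪_,_⟫ : V → V → Carrier
  ⟪ a , x ⟫ = ⟨_,_⟩ K a x

  ω : V → V → Fin e → Carrier
  ω a x i = coord a (i ↑ˡ e) * coord x (e ↑ʳ i) - coord a (e ↑ʳ i) * coord x (i ↑ˡ e)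

  form-cong : ∀ {a a′ x x′} → a ≈ᵥ a′ → x ≈ᵥ x′ → ⟪ a , x ⟫ ≈ ⟪ a′ , x′ ⟫
  form-cong a≈ x≈ = sum-cong-≋ λ i →
    +-cong (*-cong (a≈ (i ↑ˡ e)) (x≈ (e ↑ʳ i))) (-‿cong (*-cong (a≈ (e ↑ʳ i)) (x≈ (i ↑ˡ e))))

  form-congʳ : ∀ a {x x′} → x ≈ᵥ x′ → ⟪ a , x ⟫ ≈ ⟪ a , x′ ⟫
  form-congʳ a = form-cong {a} {a} (λ _ → refl)

  form-+ʳ : ∀ a x y → ⟪ a , x +ᵥ y ⟫ ≈ ⟪ a , x ⟫ + ⟪ a , y ⟫
  form-+ʳ a x y = trans (sum-cong-≋ λ i → solve 6 (λ a₁ a₂ x₁ x₂ y₁ y₂ →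
      a₁ :* (x₂ :+ y₂) :- a₂ :* (x₁ :+ y₁) := (a₁ :* x₂ :- a₂ :* x₁) :+ (a₁ :* y₂ :- a₂ :* y₁)) refl
      (coord a (i ↑ˡ e)) (coord a (e ↑ʳ i)) (coord x (i ↑ˡ e)) (coord x (e ↑ʳ i)) (coord y (i ↑ˡ e)) (coord y (e ↑ʳ i)))
    (∑-distrib-+ (ω a x) (ω a y))

  form-+ˡ : ∀ a b x → ⟪ a +ᵥ b , x ⟫ ≈ ⟪ a , x ⟫ + ⟪ b , x ⟫
  form-+ˡ a b x = trans (sum-cong-≋ λ i → solve 6 (λ a₁ a₂ b₁ b₂ x₁ x₂ →
      (a₁ :+ b₁) :* x₂ :- (a₂ :+ b₂) :* x₁ := (a₁ :* x₂ :- a₂ :* x₁) :+ (b₁ :* x₂ :- b₂ :* x₁)) refl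
      (coord a (i ↑ˡ e)) (coord a (e ↑ʳ i)) (coord b (i ↑ˡ e)) (coord b (e ↑ʳ i)) (coord x (i ↑ˡ e)) (coord x (e ↑ʳ i)))
    (∑-distrib-+ (ω a x) (ω b x))

  form-·ʳ : ∀ a k x → ⟪ a , k ·ᵥ x ⟫ ≈ k * ⟪ a , x ⟫
  form-·ʳ a k x = trans (sum-cong-≋ λ i → solve 5 (λ a₁ a₂ k x₁ x₂ →
      a₁ :* (k :* x₂) :- a₂ :* (k :* x₁) := k :* (a₁ :* x₂ :- a₂ :* x₁)) refl
      (coord a (i ↑ˡ e)) (coord a (e ↑ʳ i)) k (coord x (i ↑ˡ e)) (coord x (e ↑ʳ i)))
    (sym (*-distribˡ-sum k (ω a x)))

  form-·ˡ : ∀ k a x → ⟪ k ·ᵥ a , x ⟫ ≈ k * ⟪ a , x ⟫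
  form-·ˡ k a x = trans (sum-cong-≋ λ i → solve 5 (λ a₁ a₂ k x₁ x₂ →
      (k :* a₁) :* x₂ :- (k :* a₂) :* x₁ := k :* (a₁ :* x₂ :- a₂ :* x₁)) refl
      (coord a (i ↑ˡ e)) (coord a (e ↑ʳ i)) k (coord x (i ↑ˡ e)) (coord x (e ↑ʳ i)))
    (sym (*-distribˡ-sum k (ω a x)))

  δ : Fin (e ℕ.+ e) → Carrier → V
  δ k v = mkVect λ k′ → if does (k′ Finₚ.≟ k) then v else 0#

  δ-on : ∀ k v → coord (δ k v) k ≈ v
  δ-on k v with k Finₚ.≟ k
  ... | yes _  = refl
  ... | no k≢k = contradiction ≡.refl k≢k

  δ-off : ∀ {k k′} v → k′ ≢ k → coord (δ k v) k′ ≈ 0#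
  δ-off {k} {k′} v k′≢k with k′ Finₚ.≟ k
  ... | yes k′≡k = contradiction k′≡k k′≢k
  ... | no _     = refl

  ↑ˡ≢↑ʳ : ∀ (i j : Fin e) → i ↑ˡ e ≢ e ↑ʳ j
  ↑ˡ≢↑ʳ i j eq with ≡.trans (≡.sym (Finₚ.splitAt-↑ˡ e i e)) (≡.trans (≡.cong (splitAt e) eq) (Finₚ.splitAt-↑ʳ e e j))
  ... | ()

  sum-δ : ∀ {n} (f : Fin n → Carrier) i → (∀ j → j ≢ i → f j ≈ 0#) → sum f ≈ f i
  sum-δ {suc n} f i f≈0 = begin
    sum f                           ≈⟨ sum-remove f ⟩
    f i + sum (removeAt f i)        ≈⟨ +-congˡ (sum-cong-≋ λ j → f≈0 _ (Finₚ.punchInᵢ≢i i j)) ⟩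
    f i + sum (replicate n 0#)      ≈⟨ +-congˡ (sum-replicate-zero n) ⟩
    f i + 0#                        ≈⟨ +-identityʳ (f i) ⟩
    f i                             ∎

  form-δ-↑ʳ : ∀ a i v → ⟪ a , δ (e ↑ʳ i) v ⟫ ≈ coord a (i ↑ˡ e) * v
  form-δ-↑ʳ a i v = begin
    sum (ω a (δ (e ↑ʳ i) v))
      ≈⟨ sum-δ _ i off ⟩
    coord a (i ↑ˡ e) * coord (δ (e ↑ʳ i) v) (e ↑ʳ i) - coord a (e ↑ʳ i) * coord (δ (e ↑ʳ i) v) (i ↑ˡ e)
      ≈⟨ +-cong (*-congˡ (δ-on (e ↑ʳ i) v)) (-‿cong (*-congˡ (δ-off v (↑ˡ≢↑ʳ i i)))) ⟩
    coord a (i ↑ˡ e) * v - coord a (e ↑ʳ i) * 0#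
      ≈⟨ solve 3 (λ x y v → x :* v :- y :* con (+ 0) := x :* v) refl _ _ v ⟩
    coord a (i ↑ˡ e) * v
      ∎
    where
    off : ∀ j → j ≢ i → ω a (δ (e ↑ʳ i) v) j ≈ 0#
    off j j≢i = trans
      (+-cong (*-congˡ (δ-off v (j≢i ∘ Finₚ.↑ʳ-injective e j i))) (-‿cong (*-congˡ (δ-off v (↑ˡ≢↑ʳ j i)))))
      (solve 2 (λ x y → x :* con (+ 0) :- y :* con (+ 0) := con (+ 0)) refl _ _)

  form-δ-↑ˡ : ∀ a i v → ⟪ a , δ (i ↑ˡ e) v ⟫ ≈ - (coord a (e ↑ʳ i) * v)
  form-δ-↑ˡ a i v = begin
    sum (ω a (δ (i ↑ˡ e) v))
      ≈⟨ sum-δ _ i off ⟩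
    coord a (i ↑ˡ e) * coord (δ (i ↑ˡ e) v) (e ↑ʳ i) - coord a (e ↑ʳ i) * coord (δ (i ↑ˡ e) v) (i ↑ˡ e)
      ≈⟨ +-cong (*-congˡ (δ-off v (↑ˡ≢↑ʳ i i ∘ ≡.sym))) (-‿cong (*-congˡ (δ-on (i ↑ˡ e) v))) ⟩
    coord a (i ↑ˡ e) * 0# - coord a (e ↑ʳ i) * v
      ≈⟨ solve 3 (λ x y v → x :* con (+ 0) :- y :* v := :- (y :* v)) refl _ _ v ⟩
    - (coord a (e ↑ʳ i) * v)
      ∎
    where
    off : ∀ j → j ≢ i → ω a (δ (i ↑ˡ e) v) j ≈ 0#
    off j j≢i = trans
      (+-cong (*-congˡ (δ-off v (↑ˡ≢↑ʳ i j ∘ ≡.sym))) (-‿cong (*-congˡ (δ-off v (j≢i ∘ Finₚ.↑ˡ-injective e j i)))))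
      (solve 2 (λ x y → x :* con (+ 0) :- y :* con (+ 0) := con (+ 0)) refl _ _)

  unimodular : ∀ a → InV' K a → ∃[ y ] ⟪ a , y ⟫ ≈ 1#
  unimodular a (j , u , aⱼu≈1) with splitAt e j | Finₚ.join-splitAt e e j
  ... | inj₁ i | ≡.refl = δ (e ↑ʳ i) u , trans (form-δ-↑ʳ a i u) aⱼu≈1
  ... | inj₂ i | ≡.refl = δ (i ↑ˡ e) (- u) , (begin
    ⟪ a , δ (i ↑ˡ e) (- u) ⟫    ≈⟨ form-δ-↑ˡ a i (- u) ⟩
    - (coord a (e ↑ʳ i) * - u)   ≈⟨ solve 2 (λ x u → :- (x :* (:- u)) := x :* u) refl _ u ⟩
    coord a (e ↑ʳ i) * u         ≈⟨ aⱼu≈1 ⟩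
    1#                           ∎)

  form-+·ʳ : ∀ a x k y → ⟪ a , x +ᵥ k ·ᵥ y ⟫ ≈ ⟪ a , x ⟫ + k * ⟪ a , y ⟫
  form-+·ʳ a x k y = trans (form-+ʳ a x (k ·ᵥ y)) (+-congˡ (form-·ʳ a k y))

  form-+·ˡ : ∀ a k b x → ⟪ a +ᵥ k ·ᵥ b , x ⟫ ≈ ⟪ a , x ⟫ + k * ⟪ b , x ⟫
  form-+·ˡ a k b x = trans (form-+ˡ a (k ·ᵥ b) x) (+-congˡ (form-·ˡ k b x))

module VectorCounts {c ℓ} (K : CommutativeRing c ℓ) (r : CommutativeRing.Carrier K)
                    (ideals : ExactlyThreeIdeals K r) (q : ℕ) (residues : ResidueFieldSize K r q) (e : ℕ) where
  open CommutativeRing K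
  open IntegerSolver K
  open LocalRing K r ideals
  open ResidueCounts K r ideals q residues
  open SymplecticForm K e
  open import Relation.Binary.Reasoning.Setoid setoid

  n : ℕ
  n = e ℕ.+ e

  Digits : Setoid 0ℓ 0ℓ
  Digits = VecEq.≋-setoid (≡.setoid (Fin q)) n

  card-Digits : Card Digits U (q ℕ.^ n)
  card-Digits = card-→ (≡.setoid (Fin q)) (card-Fin q) n

  lift : (Fin n → Fin q) → V
  lift α = mkVect (t ∘ α)

  lift-cong : ∀ {α β} → (∀ j → α j ≡ β j) → lift α ≈ᵥ lift β
  lift-cong α≗β j = reflexive (≡.cong t (α≗β j))

  T : Pred V (c ⊔ ℓ)
  T = InT K r e

  T-resp : T Respects _≈ᵥ_
  T-resp x≈y Tx j = J-resp (x≈y j) (Tx j)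

  r·ᵥ-T : ∀ x → T (r ·ᵥ x)
  r·ᵥ-T x j = J-resp (*-comm _ _) (J-*r (coord x j))

  -- V ≅ Digits × Digits via (α , β) ↦ lift α + r lift β, and a predicate that ignores
  -- changes by vectors of T only depends on α.
  card-shift-invariant : ∀ {p} {Q : Pred V p} {G} → Q Respects _≈ᵥ_ →
                         (∀ {y} z → Q y → Q (y +ᵥ r ·ᵥ z)) →
                         Card Digits (Q ∘ lift) G → Card V-setoid Q (G ℕ.* q ℕ.^ n)
  card-shift-invariant {Q = Q} resp shift cQ =
    card-map σ σ-cong (λ {αβ} (Qα , _) → shift (lift (proj₂ αβ)) Qα) (λ _ _ → σ-inj) σ-onto (card-× cQ card-Digits)
    where
    σ : (Fin n → Fin q) × (Fin n → Fin q) → V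
    σ (α , β) = lift α +ᵥ r ·ᵥ lift β
    σ-cong : ∀ {u v} → Setoid._≈_ (×-setoid Digits Digits) u v → σ u ≈ᵥ σ v
    σ-cong (α≗ , β≗) j = +-cong (lift-cong α≗ j) (*-congˡ (lift-cong β≗ j))
    σ-inj : ∀ {u v} → σ u ≈ᵥ σ v → Setoid._≈_ (×-setoid Digits Digits) u v
    σ-inj eq = proj₁ ∘ digits-inj ∘ eq , proj₂ ∘ digits-inj ∘ eq
    unshift : ∀ {y} z → Q (y +ᵥ r ·ᵥ z) → Q y
    unshift {y} z Qy+rz = resp (λ j → solve 3 (λ y r z → (y :+ r :* z) :+ r :* ((:- con (+ 1)) :* z) := y) refl (coord y j) r (coord z j))
                               (shift ((- 1#) ·ᵥ z) Qy+rz)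
    σ-onto : ∀ {y} → Q y → ∃[ αβ ] ((Q ∘ lift) ⟨×⟩ U) αβ × σ αβ ≈ᵥ y
    σ-onto {y} Qy = (α , β) , (unshift (lift β) (resp (sym ∘ σαβ≈y) Qy) , tt) , σαβ≈y
      where
      α β : Fin n → Fin q
      α j = proj₁ (proj₁ (digits-onto (coord y j)))
      β j = proj₂ (proj₁ (digits-onto (coord y j)))
      σαβ≈y : σ (α , β) ≈ᵥ y
      σαβ≈y j = proj₂ (digits-onto (coord y j))

  card-V : Card V-setoid U (q ℕ.^ n ℕ.* q ℕ.^ n)
  card-V = card-shift-invariant (λ _ _ → tt) (λ _ _ → tt) card-Digits

  card-⊆T : ∀ {p} {Q : Pred V p} {G} → Q Respects _≈ᵥ_ → Q ⊆ T →
            Card Digits (λ β → Q (r ·ᵥ lift β)) G → Card V-setoid Q G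
  card-⊆T {Q = Q} resp Q⊆T = card-map (λ β → r ·ᵥ lift β) (λ β≗ j → *-congˡ (lift-cong β≗ j)) (λ Qβ → Qβ) (λ _ _ → inj) onto
    where
    inj : ∀ {β β′} → r ·ᵥ lift β ≈ᵥ r ·ᵥ lift β′ → ∀ j → β j ≡ β′ j
    inj eq j = t*r-inj (trans (*-comm _ r) (trans (eq j) (*-comm r _)))
    onto : ∀ {y} → Q y → ∃[ β ] Q (r ·ᵥ lift β) × r ·ᵥ lift β ≈ᵥ y
    onto {y} Qy = β , resp (sym ∘ rβ≈y) Qy , rβ≈y
      where
      multiplier : Fin n → Carrier
      multiplier j = proj₁ (Q⊆T Qy j)
      β : Fin n → Fin q
      β j = proj₁ (*r-residue (multiplier j))
      rβ≈y : r ·ᵥ lift β ≈ᵥ y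
      rβ≈y j = begin
        r * t (β j)          ≈⟨ *-comm r _ ⟩
        t (β j) * r          ≈⟨ proj₂ (*r-residue (multiplier j)) ⟨
        multiplier j * r     ≈⟨ proj₂ (Q⊆T Qy j) ⟨
        coord y j            ∎

  card-T : Card V-setoid T (q ℕ.^ n)
  card-T = card-⊆T T-resp (λ Ty → Ty) (card-cong ((λ _ → r·ᵥ-T _) , _) card-Digits)

module Dichotomy {c ℓ} (K : CommutativeRing c ℓ) (r : CommutativeRing.Carrier K)
                 (ideals : ExactlyThreeIdeals K r) (e : ℕ) where
  open CommutativeRing K
  open IntegerSolver K
  open LocalRing K r ideals
  open SymplecticForm K e
  open import Relation.Binary.Reasoning.Setoid setoid

  record DualPair (a b : V) : Set (c ⊔ ℓ) where
    field
      x₁ x₂ : V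
      a·x₁≈1 : ⟪ a , x₁ ⟫ ≈ 1#
      b·x₁≈0 : ⟪ b , x₁ ⟫ ≈ 0#
      a·x₂≈0 : ⟪ a , x₂ ⟫ ≈ 0#
      b·x₂≈1 : ⟪ b , x₂ ⟫ ≈ 1#

  ProportionalModJ : V → V → Set (c ⊔ ℓ)
  ProportionalModJ a b = ∃[ μ ] Unit μ × r ·ᵥ b ≈ᵥ μ ·ᵥ r ·ᵥ a

  proportional-trans : ∀ {a b x} → ProportionalModJ a b → ProportionalModJ b x → ProportionalModJ a x
  proportional-trans {a} {b} {x} (μ , μ-unit , rb≈μra) (ν , ν-unit , rx≈νrb) = ν * μ , Unit-* ν-unit μ-unit , λ j → begin
    r * coord x j             ≈⟨ rx≈νrb j ⟩
    ν * (r * coord b j)       ≈⟨ *-congˡ (rb≈μra j) ⟩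
    ν * (μ * (r * coord a j)) ≈⟨ *-assoc ν μ _ ⟨
    (ν * μ) * (r * coord a j) ∎

  proportional-sym : ∀ {a b} → ProportionalModJ a b → ProportionalModJ b a
  proportional-sym {a} {b} (μ , μ-unit@(μ⁻¹ , μμ⁻¹≈1) , rb≈μra) = μ⁻¹ , Unit-inverse μ-unit , λ j → begin
    r * coord a j                 ≈⟨ *-identityˡ _ ⟨
    1# * (r * coord a j)          ≈⟨ *-congʳ (trans (*-comm μ⁻¹ μ) μμ⁻¹≈1) ⟨
    (μ⁻¹ * μ) * (r * coord a j)   ≈⟨ *-assoc μ⁻¹ μ _ ⟩
    μ⁻¹ * (μ * (r * coord a j))   ≈⟨ *-congˡ (rb≈μra j) ⟨
    μ⁻¹ * (r * coord b j)         ∎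

  module _ {a b : V} (a∈V′ : InV' K a) (b∈V′ : InV' K b) where
    private
      y : V
      y = proj₁ (unimodular a a∈V′)
      a·y≈1 : ⟪ a , y ⟫ ≈ 1#
      a·y≈1 = proj₂ (unimodular a a∈V′)
      μ : Carrier
      μ = ⟪ b , y ⟫
      b′ : V
      b′ = b +ᵥ (- μ) ·ᵥ a

    dualPair : InV' K b′ → DualPair a b
    dualPair b′∈V′ = record
      { x₁ = x₁ ; x₂ = x₂ ; a·x₁≈1 = a·x₁≈1 ; b·x₁≈0 = b·x₁≈0 ; a·x₂≈0 = a·x₂≈0 ; b·x₂≈1 = b·x₂≈1 }
      where
      z : V
      z = proj₁ (unimodular b′ b′∈V′)
      x₂ x₁ : V
      x₂ = z +ᵥ (- ⟪ a , z ⟫) ·ᵥ y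
      x₁ = y +ᵥ (- μ) ·ᵥ x₂
      a·x₂≈0 : ⟪ a , x₂ ⟫ ≈ 0#
      a·x₂≈0 = begin
        ⟪ a , x₂ ⟫                               ≈⟨ form-+·ʳ a z _ y ⟩
        ⟪ a , z ⟫ + (- ⟪ a , z ⟫) * ⟪ a , y ⟫    ≈⟨ +-congˡ (*-congˡ a·y≈1) ⟩
        ⟪ a , z ⟫ + (- ⟪ a , z ⟫) * 1#          ≈⟨ solve 1 (λ u → u :+ (:- u) :* con (+ 1) := con (+ 0)) refl _ ⟩
        0#                                       ∎
      b·x₂≈1 : ⟪ b , x₂ ⟫ ≈ 1#
      b·x₂≈1 = begin
        ⟪ b , x₂ ⟫                               ≈⟨ form-+·ʳ b z _ y ⟩
        ⟪ b , z ⟫ + (- ⟪ a , z ⟫) * μ            ≈⟨ solve 3 (λ u v w → u :+ (:- v) :* w := u :+ (:- w) :* v) refl _ _ _ ⟩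
        ⟪ b , z ⟫ + (- μ) * ⟪ a , z ⟫            ≈⟨ form-+·ˡ b (- μ) a z ⟨
        ⟪ b′ , z ⟫                               ≈⟨ proj₂ (unimodular b′ b′∈V′) ⟩
        1#                                       ∎
      a·x₁≈1 : ⟪ a , x₁ ⟫ ≈ 1#
      a·x₁≈1 = begin
        ⟪ a , x₁ ⟫                               ≈⟨ form-+·ʳ a y _ x₂ ⟩
        ⟪ a , y ⟫ + (- μ) * ⟪ a , x₂ ⟫           ≈⟨ +-cong a·y≈1 (*-congˡ a·x₂≈0) ⟩
        1# + (- μ) * 0#                          ≈⟨ solve 1 (λ u → con (+ 1) :+ (:- u) :* con (+ 0) := con (+ 1)) refl _ ⟩
        1#                                       ∎
      b·x₁≈0 : ⟪ b , x₁ ⟫ ≈ 0#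
      b·x₁≈0 = begin
        ⟪ b , x₁ ⟫                               ≈⟨ form-+·ʳ b y _ x₂ ⟩
        μ + (- μ) * ⟪ b , x₂ ⟫                   ≈⟨ +-congˡ (*-congˡ b·x₂≈1) ⟩
        μ + (- μ) * 1#                           ≈⟨ solve 1 (λ u → u :+ (:- u) :* con (+ 1) := con (+ 0)) refl _ ⟩
        0#                                       ∎

    proportional : ¬ InV' K b′ → ProportionalModJ a b
    proportional b′∉V′ = μ , μ-unit , r·b≈μ·r·a
      where
      b′-J : ∀ j → J (coord b′ j)
      b′-J j = Sum.[ (λ u → ⊥-elim (b′∉V′ (j , u))) , (λ Jb′ⱼ → Jb′ⱼ) ]′ (unit⊎J (coord b′ j))
      b≈b′+μa : ∀ j → coord b j ≈ coord b′ j + μ * coord a j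
      b≈b′+μa j = solve 3 (λ b m a → b := (b :+ (:- m) :* a) :+ m :* a) refl (coord b j) μ (coord a j)
      μ-unit : Unit μ
      μ-unit = ¬J⇒Unit λ Jμ → unit∉J (proj₂ b∈V′) (J-resp (sym (b≈b′+μa j)) (J-+ (b′-J j) (J-*ʳ (coord a j) Jμ)))
        where j = proj₁ b∈V′
      r·b≈μ·r·a : r ·ᵥ b ≈ᵥ μ ·ᵥ r ·ᵥ a
      r·b≈μ·r·a j = begin
        r * coord b j                          ≈⟨ *-congˡ (b≈b′+μa j) ⟩
        r * (coord b′ j + μ * coord a j)       ≈⟨ distribˡ r _ _ ⟩
        r * coord b′ j + r * (μ * coord a j)   ≈⟨ +-congʳ (r*J≈0 (b′-J j)) ⟩
        0# + r * (μ * coord a j)               ≈⟨ solve 3 (λ r m a → con (+ 0) :+ r :* (m :* a) := m :* (r :* a)) refl r μ (coord a j) ⟩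
        μ * (r * coord a j)                    ∎

    dualPair⊎proportional : DualPair a b ⊎ ProportionalModJ a b
    dualPair⊎proportional with Finₚ.any? (Unit? ∘ coord b′)
    ... | yes b′∈V′ = inj₁ (dualPair b′∈V′)
    ... | no  b′∉V′ = inj₂ (proportional b′∉V′)

q^[n∸1]*q≡q^n : ∀ q n → 1 ℕ.≤ n → q ℕ.^ (n ∸ 1) ℕ.* q ≡ q ℕ.^ n
q^[n∸1]*q≡q^n q (suc n) _ = ℕₚ.*-comm (q ℕ.^ n) q

module Hyperplane {c ℓ ℓh} (K : CommutativeRing c ℓ) (r : CommutativeRing.Carrier K)
                  (ideals : ExactlyThreeIdeals K r) (q : ℕ) (residues : ResidueFieldSize K r q)
                  (_≟_ : Decidable (CommutativeRing._≈_ K)) (e : ℕ)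
                  (H : Pred (Vect K e) ℓh) (hyperplane : IsHyperplane K r e H) where
  open CommutativeRing K hiding (zero)
  open IntegerSolver K
  open LocalRing K r ideals
  open ResidueCounts K r ideals q residues
  open SymplecticForm K e
  open VectorCounts K r ideals q residues e
  open import Algebra.Properties.Semiring.Sum semiring using (sum; sum-cong-≋; ∑-distrib-+; *-distribˡ-sum)
  open import Relation.Binary.Reasoning.Setoid setoid
  open IsSubspace (proj₁ hyperplane) renaming (resp to H-resp)

  private
    d : ℕ
    d = n ∸ 1
    w : Fin d → V
    w = proj₁ (proj₂ hyperplane)
    w∈H : ∀ i → H (w i)
    w∈H = proj₁ (proj₂ (proj₂ hyperplane))
    w-independent : ∀ z → linComb K r e z w ≈ᵥ 0ᵥ K → ∀ i → J (z i)
    w-independent = proj₁ (proj₂ (proj₂ (proj₂ hyperplane)))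

  H-linComb : ∀ {m} (z : Fin m → Carrier) (ws : Fin m → V) → (∀ i → H (ws i)) → H (linComb K r e z ws)
  H-linComb {zero}  z ws ws∈H = H-resp (λ _ → refl) zero∈
  H-linComb {suc m} z ws ws∈H = H-resp (λ _ → refl)
    (+-cl (·-cl (z zero) (ws∈H zero)) (H-linComb (z ∘ suc) (ws ∘ suc) (ws∈H ∘ suc)))

  linComb-sub : ∀ z z′ → linComb K r e (λ i → z i - z′ i) w ≈ᵥ linComb K r e z w +ᵥ (- 1#) ·ᵥ linComb K r e z′ w
  linComb-sub z z′ j = begin
    sum (λ i → (z i - z′ i) * coord (w i) j)
      ≈⟨ sum-cong-≋ (λ i → solve 3 (λ a b x → (a :- b) :* x := a :* x :+ (:- con (+ 1)) :* (b :* x)) refl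
                                   (z i) (z′ i) (coord (w i) j)) ⟩
    sum (λ i → z i * coord (w i) j + (- 1#) * (z′ i * coord (w i) j))
      ≈⟨ ∑-distrib-+ (λ i → z i * coord (w i) j) _ ⟩
    sum (λ i → z i * coord (w i) j) + sum (λ i → (- 1#) * (z′ i * coord (w i) j))
      ≈⟨ +-congˡ (*-distribˡ-sum (- 1#) (λ i → z′ i * coord (w i) j)) ⟨
    sum (λ i → z i * coord (w i) j) + (- 1#) * sum (λ i → z′ i * coord (w i) j)
      ∎

  open Dichotomy K r ideals e using (ProportionalModJ)

  inClass⇒proportional : ∀ {u x} → InClassC K r e H u x → ProportionalModJ u x
  inClass⇒proportional {u} {x} (h , h∈H , λ′ , λ′-unit@(λ′⁻¹ , λ′λ′⁻¹≈1) , u+h≈λ′x) =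
    λ′⁻¹ , Unit-inverse λ′-unit , λ j → begin
    r * coord x j                            ≈⟨ *-identityˡ _ ⟨
    1# * (r * coord x j)                     ≈⟨ *-congʳ λ′λ′⁻¹≈1 ⟨
    (λ′ * λ′⁻¹) * (r * coord x j)
      ≈⟨ solve 4 (λ l v r x → (l :* v) :* (r :* x) := v :* (r :* (l :* x))) refl λ′ λ′⁻¹ r (coord x j) ⟩
    λ′⁻¹ * (r * (λ′ * coord x j))            ≈⟨ *-congˡ (*-congˡ (u+h≈λ′x j)) ⟨
    λ′⁻¹ * (r * (coord u j + coord h j))     ≈⟨ *-congˡ (distribˡ r _ _) ⟩
    λ′⁻¹ * (r * coord u j + r * coord h j)   ≈⟨ *-congˡ (+-congˡ (r*J≈0 (⊆T h∈H j))) ⟩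
    λ′⁻¹ * (r * coord u j + 0#)              ≈⟨ *-congˡ (+-identityʳ _) ⟩
    λ′⁻¹ * (r * coord u j)                   ∎

  proportional⇒difference∈T : ∀ {u x μ} → r ·ᵥ x ≈ᵥ μ ·ᵥ r ·ᵥ u → T (x +ᵥ (- μ) ·ᵥ u)
  proportional⇒difference∈T {u} {x} {μ} rx≈μru j = *r≈0⇒J (begin
    (coord x j + (- μ) * coord u j) * r
      ≈⟨ solve 4 (λ x m u r → (x :+ (:- m) :* u) :* r := r :* x :- m :* (r :* u)) refl (coord x j) μ (coord u j) r ⟩
    r * coord x j - μ * (r * coord u j)        ≈⟨ +-congʳ (rx≈μru j) ⟩
    μ * (r * coord u j) - μ * (r * coord u j)  ≈⟨ -‿inverseʳ _ ⟩
    0#                                         ∎)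

  module _ {u : V} (r·u∉H : ¬ H (r ·ᵥ u)) where

    Coefficients : Setoid 0ℓ 0ℓ
    Coefficients = ×-setoid (VecEq.≋-setoid (≡.setoid (Fin q)) d) (≡.setoid (Fin q))

    card-Coefficients : Card Coefficients (U ⟨×⟩ U) (q ℕ.^ d ℕ.* q)
    card-Coefficients = card-× (card-→ (≡.setoid (Fin q)) (card-Fin q) d) (card-Fin q)

    combination : (Fin d → Fin q) × Fin q → V
    combination (α , k) = linComb K r e (t ∘ α) w +ᵥ t k ·ᵥ r ·ᵥ u

    combination-T : ∀ αk → T (combination αk)
    combination-T (α , k) j = J-+ (⊆T (H-linComb (t ∘ α) w w∈H) j) (J-*ˡ (t k) (r·ᵥ-T u j))

    H+D·r·u≈0⇒D∈J : ∀ {h D} → H h → (∀ j → coord h j + D * (r * coord u j) ≈ 0#) → J D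
    H+D·r·u≈0⇒D∈J {h} {D} h∈H h+Dru≈0 with J? D
    ... | yes D∈J = D∈J
    ... | no  D∉J = ⊥-elim (r·u∉H (H-resp ru≈ (·-cl (- D⁻¹) h∈H)))
      where
      D⁻¹ : Carrier
      D⁻¹ = proj₁ (¬J⇒Unit D∉J)
      ru≈ : (- D⁻¹) ·ᵥ h ≈ᵥ r ·ᵥ u
      ru≈ j = begin
        - D⁻¹ * coord h j
          ≈⟨ solve 4 (λ v l d x → :- v :* l := (:- v) :* (l :+ d :* x) :+ (d :* v) :* x) refl D⁻¹ (coord h j) D (r * coord u j) ⟩
        (- D⁻¹) * (coord h j + D * (r * coord u j)) + (D * D⁻¹) * (r * coord u j)
          ≈⟨ +-cong (*-congˡ (h+Dru≈0 j)) (*-congʳ (proj₂ (¬J⇒Unit D∉J))) ⟩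
        (- D⁻¹) * 0# + 1# * (r * coord u j)
          ≈⟨ solve 2 (λ v x → (:- v) :* con (+ 0) :+ con (+ 1) :* x := x) refl D⁻¹ (r * coord u j) ⟩
        r * coord u j ∎

    combination-inj : ∀ {αk αk′} → combination αk ≈ᵥ combination αk′ → Setoid._≈_ Coefficients αk αk′
    combination-inj {α , k} {α′ , k′} eq = (λ i → t-inj (w-independent _ L≈0 i)) , t-inj D∈J
      where
      D : Carrier
      D = t k - t k′
      L : V
      L = linComb K r e (λ i → t (α i) - t (α′ i)) w
      L+Dru≈0 : ∀ j → coord L j + D * (r * coord u j) ≈ 0#
      L+Dru≈0 j = begin
        coord L j + D * (r * coord u j)
          ≈⟨ +-congʳ (linComb-sub (t ∘ α) (t ∘ α′) j) ⟩
        (coord (linComb K r e (t ∘ α) w) j + (- 1#) * coord (linComb K r e (t ∘ α′) w) j) + D * (r * coord u j)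
          ≈⟨ solve 5 (λ A A′ a a′ ru → (A :+ (:- con (+ 1)) :* A′) :+ (a :- a′) :* ru := (A :+ a :* ru) :- (A′ :+ a′ :* ru))
                     refl _ _ (t k) (t k′) (r * coord u j) ⟩
        coord (combination (α , k)) j - coord (combination (α′ , k′)) j
          ≈⟨ +-congʳ (eq j) ⟩
        coord (combination (α′ , k′)) j - coord (combination (α′ , k′)) j
          ≈⟨ -‿inverseʳ _ ⟩
        0# ∎
      D∈J : J D
      D∈J = H+D·r·u≈0⇒D∈J (H-linComb _ w w∈H) L+Dru≈0
      L≈0 : L ≈ᵥ 0ᵥ K
      L≈0 j = begin
        coord L j
          ≈⟨ solve 4 (λ l d r u → l := (l :+ d :* (r :* u)) :- (d :* r) :* u) refl (coord L j) D r (coord u j) ⟩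
        (coord L j + D * (r * coord u j)) - (D * r) * coord u j
          ≈⟨ +-cong (L+Dru≈0 j) (-‿cong (*-congʳ (J*J≈0 D∈J J-r))) ⟩
        0# - 0# * coord u j
          ≈⟨ solve 1 (λ x → con (+ 0) :- con (+ 0) :* x := con (+ 0)) refl (coord u j) ⟩
        0# ∎

    Image : Pred V ℓ
    Image y = ∃[ i ] combination (Card.elem card-Coefficients i) ≈ᵥ y

    Image-resp : Image Respects _≈ᵥ_
    Image-resp y≈y′ (i , eq) = i , λ j → trans (eq j) (y≈y′ j)

    Image? : Decidable₁ Image
    Image? y = Finₚ.any? λ i → Finₚ.all? λ j → coord (combination (Card.elem card-Coefficients i)) j ≟ coord y j

    card-Image : Card V-setoid Image (q ℕ.^ d ℕ.* q)
    card-Image = record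
      { elem       = combination ∘ Card.elem card-Coefficients
      ; elem∈      = λ i → i , λ _ → refl
      ; elem-inj   = Card.elem-inj card-Coefficients ∘ combination-inj
      ; elem-cover = λ y∈Image → y∈Image
      }

    -- The q^(2e−1) · q combinations are distinct because r u ∉ H, so by counting they exhaust T.
    T⊆Image : 1 ℕ.≤ e → T ⊆ Image
    T⊆Image 1≤e = card-⊆⇒⊇ Image-resp T-resp Image? Image⊆T card-Image
      (≡.subst (Card V-setoid T) (≡.sym (q^[n∸1]*q≡q^n q n (ℕₚ.≤-trans 1≤e (ℕₚ.m≤m+n e e)))) card-T)
      where
      Image⊆T : Image ⊆ T
      Image⊆T (i , eq) = T-resp eq (combination-T (Card.elem card-Coefficients i))

    proportional⇒inClass : 1 ℕ.≤ e → ∀ {x} → ProportionalModJ u x → InClassC K r e H u x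
    proportional⇒inClass 1≤e {x} (μ , μ-unit , rx≈μru) =
      ν⁻¹ ·ᵥ L , ·-cl ν⁻¹ (H-linComb _ w w∈H) , ν⁻¹ , Unit-inverse ν-unit , u+h≈ν⁻¹x
      where
      x-μu∈T : T (x +ᵥ (- μ) ·ᵥ u)
      x-μu∈T = proportional⇒difference∈T rx≈μru
      i : Fin (q ℕ.^ d ℕ.* q)
      i = proj₁ (T⊆Image 1≤e x-μu∈T)
      α = proj₁ (Card.elem card-Coefficients i)
      k = proj₂ (Card.elem card-Coefficients i)
      L : V
      L = linComb K r e (t ∘ α) w
      ν : Carrier
      ν = μ + t k * r
      ν-unit : Unit ν
      ν-unit = Unit-+J μ-unit (J-*r (t k))
      ν⁻¹ : Carrier
      ν⁻¹ = proj₁ ν-unit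
      u+h≈ν⁻¹x : u +ᵥ ν⁻¹ ·ᵥ L ≈ᵥ ν⁻¹ ·ᵥ x
      u+h≈ν⁻¹x j = begin
        coord u j + ν⁻¹ * coord L j                                       ≈⟨ +-congʳ (*-identityˡ _) ⟨
        1# * coord u j + ν⁻¹ * coord L j                                  ≈⟨ +-congʳ (*-congʳ (proj₂ ν-unit)) ⟨
        (ν * ν⁻¹) * coord u j + ν⁻¹ * coord L j
          ≈⟨ solve 6 (λ m c r v u l → ((m :+ c :* r) :* v) :* u :+ v :* l := v :* (m :* u :+ (l :+ c :* (r :* u))))
                     refl μ (t k) r ν⁻¹ (coord u j) (coord L j) ⟩
        ν⁻¹ * (μ * coord u j + (coord L j + t k * (r * coord u j)))
          ≈⟨ *-congˡ (+-congˡ (proj₂ (T⊆Image 1≤e x-μu∈T) j)) ⟩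
        ν⁻¹ * (μ * coord u j + (coord x j + (- μ) * coord u j))
          ≈⟨ *-congˡ (solve 3 (λ m u x → m :* u :+ (x :+ (:- m) :* u) := x) refl μ (coord u j) (coord x j)) ⟩
        ν⁻¹ * coord x j
          ∎

module LeadingUnit {c ℓ} (K : CommutativeRing c ℓ) (r : CommutativeRing.Carrier K)
                   (ideals : ExactlyThreeIdeals K r) where
  open CommutativeRing K hiding (zero)
  open LocalRing K r ideals

  leading : ∀ {m} → (Fin m → Carrier) → Carrier
  leading {zero}  f = 1#
  leading {suc m} f = if does (Unit? (f zero)) then f zero else leading (f ∘ suc)

  leading-cong : ∀ {m} {f g : Fin m → Carrier} → (∀ i → f i ≈ g i) → leading f ≈ leading g
  leading-cong {zero}          f≈g = refl
  leading-cong {suc m} {f} {g} f≈g with Unit? (f zero) | Unit? (g zero)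
  ... | yes _      | yes _      = f≈g zero
  ... | no  _      | no  _      = leading-cong (f≈g ∘ suc)
  ... | yes f₀-unit | no ¬g₀-unit = contradiction (Unit-resp (f≈g zero) f₀-unit) ¬g₀-unit
  ... | no ¬f₀-unit | yes g₀-unit = contradiction (Unit-resp (sym (f≈g zero)) g₀-unit) ¬f₀-unit

  leading-unit : ∀ {m} (f : Fin m → Carrier) → ∃[ i ] Unit (f i) → Unit (leading f)
  leading-unit {suc m} f (i , fᵢ-unit) with Unit? (f zero) | i
  ... | yes f₀-unit | _     = f₀-unit
  ... | no ¬f₀-unit | zero  = contradiction fᵢ-unit ¬f₀-unit
  ... | no _        | suc i = leading-unit (f ∘ suc) (i , fᵢ-unit)

  leading-scale : ∀ {m λ′} (f : Fin m → Carrier) → Unit λ′ → ∃[ i ] Unit (f i) →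
                  leading (λ i → λ′ * f i) ≈ λ′ * leading f
  leading-scale {suc m} {λ′} f λ′-unit (i , fᵢ-unit) with Unit? (λ′ * f zero) | Unit? (f zero) | i
  ... | yes _ | yes _ | _ = refl
  ... | no ¬λf₀-unit | yes f₀-unit | _ = contradiction (Unit-* λ′-unit f₀-unit) ¬λf₀-unit
  ... | yes λf₀-unit | no ¬f₀-unit | _ = contradiction (Unit-*⇒Unitʳ λf₀-unit) ¬f₀-unit
  ... | no _ | no ¬f₀-unit | zero  = contradiction fᵢ-unit ¬f₀-unit
  ... | no _ | no _        | suc i = leading-scale (f ∘ suc) λ′-unit (i , fᵢ-unit)

record CountingIdentities (q n N : ℕ) : Set where
  field
    F nZ nU G N′ : ℕ
    total   : q ℕ.* q ℕ.* (q ℕ.* q ℕ.* F) ≡ q ℕ.^ n ℕ.* q ℕ.^ n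
    nonzero : 1 ℕ.+ nZ ≡ q ℕ.* q
    units   : q ℕ.+ nU ≡ q ℕ.* q
    split   : G ℕ.+ N′ ≡ nZ ℕ.* (nZ ℕ.* F)
    shift   : nU ℕ.* (nU ℕ.* F) ≡ G ℕ.* q ℕ.^ n
    orbits  : N ℕ.* nU ≡ N′

module CommonNeighbourCount {c ℓ} (K : CommutativeRing c ℓ) (r : CommutativeRing.Carrier K)
                            (ideals : ExactlyThreeIdeals K r) (q : ℕ) (residues : ResidueFieldSize K r q)
                            (_≟_ : Decidable (CommutativeRing._≈_ K)) (e : ℕ) {a b : Vect K e}
                            (pair : Dichotomy.DualPair K r ideals e a b) where
  open CommutativeRing K
  open IntegerSolver K
  open LocalRing K r ideals
  open ResidueCounts K r ideals q residues
  open SymplecticForm K e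
  open VectorCounts K r ideals q residues e
  open Dichotomy.DualPair pair
  open import Algebra.Properties.Ring ring using (+-cancelˡ)
  open import Relation.Binary.Reasoning.Setoid setoid

  φ₁ φ₂ : V → Carrier
  φ₁ = ⟪ a ,_⟫
  φ₂ = ⟪ b ,_⟫

  ByValues : ∀ {p p′} → Pred Carrier p → Pred Carrier p′ → Pred V (p ⊔ p′)
  ByValues P₁ P₂ y = P₁ (φ₁ y) × P₂ (φ₂ y)

  Ker : Pred V ℓ
  Ker = ByValues (_≈ 0#) (_≈ 0#)

  Ker-resp : Ker Respects _≈ᵥ_
  Ker-resp y≈y′ (φ₁y≈0 , φ₂y≈0) = trans (sym (form-congʳ a y≈y′)) φ₁y≈0 , trans (sym (form-congʳ b y≈y′)) φ₂y≈0

  Ker-count : ∃[ F ] Card V-setoid Ker F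
  Ker-count = Prod.map₂ (card-cong (proj₂ , (tt ,_))) (card-filter Ker-resp (λ y → (φ₁ y ≟ 0#) ×-dec (φ₂ y ≟ 0#)) card-V)

  F : ℕ
  F = proj₁ Ker-count

  card-Ker : Card V-setoid Ker F
  card-Ker = proj₂ Ker-count

  Ψ : Carrier × Carrier × V → V
  Ψ (α , β , k) = α ·ᵥ x₁ +ᵥ β ·ᵥ x₂ +ᵥ k

  φ₁-Ψ : ∀ α β k → φ₁ (Ψ (α , β , k)) ≈ α + φ₁ k
  φ₁-Ψ α β k = begin
    φ₁ (Ψ (α , β , k))                         ≈⟨ form-+ʳ a (α ·ᵥ x₁ +ᵥ β ·ᵥ x₂) k ⟩
    φ₁ (α ·ᵥ x₁ +ᵥ β ·ᵥ x₂) + φ₁ k              ≈⟨ +-congʳ (form-+·ʳ a (α ·ᵥ x₁) β x₂) ⟩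
    (φ₁ (α ·ᵥ x₁) + β * φ₁ x₂) + φ₁ k
      ≈⟨ +-congʳ (+-cong (trans (form-·ʳ a α x₁) (*-congˡ a·x₁≈1)) (*-congˡ a·x₂≈0)) ⟩
    (α * 1# + β * 0#) + φ₁ k
      ≈⟨ solve 3 (λ α β y → (α :* con (+ 1) :+ β :* con (+ 0)) :+ y := α :+ y) refl α β (φ₁ k) ⟩
    α + φ₁ k                                   ∎

  φ₂-Ψ : ∀ α β k → φ₂ (Ψ (α , β , k)) ≈ β + φ₂ k
  φ₂-Ψ α β k = begin
    φ₂ (Ψ (α , β , k))                         ≈⟨ form-+ʳ b (α ·ᵥ x₁ +ᵥ β ·ᵥ x₂) k ⟩
    φ₂ (α ·ᵥ x₁ +ᵥ β ·ᵥ x₂) + φ₂ k              ≈⟨ +-congʳ (form-+·ʳ b (α ·ᵥ x₁) β x₂) ⟩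
    (φ₂ (α ·ᵥ x₁) + β * φ₂ x₂) + φ₂ k
      ≈⟨ +-congʳ (+-cong (trans (form-·ʳ b α x₁) (*-congˡ b·x₁≈0)) (*-congˡ b·x₂≈1)) ⟩
    (α * 0# + β * 1#) + φ₂ k
      ≈⟨ solve 3 (λ α β y → (α :* con (+ 0) :+ β :* con (+ 1)) :+ y := β :+ y) refl α β (φ₂ k) ⟩
    β + φ₂ k                                   ∎

  -- Ψ identifies K × K × Ker with V, because (x₁ , x₂) is dual to (a , b).
  card-ByValues : ∀ {p p′} {P₁ : Pred Carrier p} {P₂ : Pred Carrier p′} {m₁ m₂} →
                  P₁ Respects _≈_ → P₂ Respects _≈_ → Card setoid P₁ m₁ → Card setoid P₂ m₂ →
                  Card V-setoid (ByValues P₁ P₂) (m₁ ℕ.* (m₂ ℕ.* F))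
  card-ByValues {P₁ = P₁} {P₂} resp₁ resp₂ c₁ c₂ =
    card-map {P = P₁ ⟨×⟩ P₂ ⟨×⟩ Ker} {Q = ByValues P₁ P₂} Ψ Ψ-cong (λ {u} → Ψ∈ {u}) (λ {u} {v} → Ψ-inj {u} {v}) Ψ-onto
      (card-× c₁ (card-× c₂ card-Ker))
    where
    φ-Ψ : ∀ α β k → Ker k → φ₁ (Ψ (α , β , k)) ≈ α × φ₂ (Ψ (α , β , k)) ≈ β
    φ-Ψ α β k (φ₁k≈0 , φ₂k≈0) =
      trans (φ₁-Ψ α β k) (trans (+-congˡ φ₁k≈0) (+-identityʳ α)) ,
      trans (φ₂-Ψ α β k) (trans (+-congˡ φ₂k≈0) (+-identityʳ β))
    kernel-part : ∀ α β k j → coord k j ≈ coord (Ψ (α , β , k)) j - α * coord x₁ j - β * coord x₂ j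
    kernel-part α β k j =
      solve 5 (λ a b x y k → k := (a :* x :+ b :* y :+ k) :- a :* x :- b :* y) refl α β (coord x₁ j) (coord x₂ j) (coord k j)
    Ψ-cong : ∀ {u v} → Setoid._≈_ (×-setoid setoid (×-setoid setoid V-setoid)) u v → Ψ u ≈ᵥ Ψ v
    Ψ-cong (α≈ , β≈ , k≈) j = +-cong (+-cong (*-congʳ α≈) (*-congʳ β≈)) (k≈ j)
    Ψ∈ : ∀ {u} → (P₁ ⟨×⟩ P₂ ⟨×⟩ Ker) u → ByValues P₁ P₂ (Ψ u)
    Ψ∈ {α , β , k} (P₁α , P₂β , k∈Ker) = resp₁ (sym (proj₁ (φ-Ψ α β k k∈Ker))) P₁α , resp₂ (sym (proj₂ (φ-Ψ α β k k∈Ker))) P₂β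
    Ψ-inj : ∀ {u v} → (P₁ ⟨×⟩ P₂ ⟨×⟩ Ker) u → (P₁ ⟨×⟩ P₂ ⟨×⟩ Ker) v → Ψ u ≈ᵥ Ψ v →
            Setoid._≈_ (×-setoid setoid (×-setoid setoid V-setoid)) u v
    Ψ-inj {α , β , k} {α′ , β′ , k′} (_ , _ , k∈Ker) (_ , _ , k′∈Ker) Ψu≈Ψv = α≈α′ , β≈β′ , k≈k′
      where
      α≈α′ : α ≈ α′
      α≈α′ = trans (sym (proj₁ (φ-Ψ α β k k∈Ker)))
               (trans (form-congʳ a {Ψ (α , β , k)} {Ψ (α′ , β′ , k′)} Ψu≈Ψv) (proj₁ (φ-Ψ α′ β′ k′ k′∈Ker)))
      β≈β′ : β ≈ β′
      β≈β′ = trans (sym (proj₂ (φ-Ψ α β k k∈Ker)))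
               (trans (form-congʳ b {Ψ (α , β , k)} {Ψ (α′ , β′ , k′)} Ψu≈Ψv) (proj₂ (φ-Ψ α′ β′ k′ k′∈Ker)))
      k≈k′ : k ≈ᵥ k′
      k≈k′ j = trans (kernel-part α β k j)
        (trans (+-cong (+-cong (Ψu≈Ψv j) (-‿cong (*-congʳ α≈α′))) (-‿cong (*-congʳ β≈β′))) (sym (kernel-part α′ β′ k′ j)))
    Ψ-onto : ∀ {y} → ByValues P₁ P₂ y → ∃[ u ] (P₁ ⟨×⟩ P₂ ⟨×⟩ Ker) u × Ψ u ≈ᵥ y
    Ψ-onto {y} (P₁φ₁y , P₂φ₂y) = (φ₁ y , φ₂ y , k) , (P₁φ₁y , P₂φ₂y , φ₁k≈0 , φ₂k≈0) , Ψ≈y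
      where
      k : V
      k = y +ᵥ (- φ₁ y) ·ᵥ x₁ +ᵥ (- φ₂ y) ·ᵥ x₂
      Ψ≈y : Ψ (φ₁ y , φ₂ y , k) ≈ᵥ y
      Ψ≈y j = solve 5 (λ a b x z y → a :* x :+ b :* z :+ (y :+ (:- a) :* x :+ (:- b) :* z) := y) refl
                (φ₁ y) (φ₂ y) (coord x₁ j) (coord x₂ j) (coord y j)
      φ₁k≈0 : φ₁ k ≈ 0#
      φ₁k≈0 = +-cancelˡ (φ₁ y) (φ₁ k) 0#
        (trans (sym (φ₁-Ψ (φ₁ y) (φ₂ y) k)) (trans (form-congʳ a Ψ≈y) (sym (+-identityʳ (φ₁ y)))))
      φ₂k≈0 : φ₂ k ≈ 0#
      φ₂k≈0 = +-cancelˡ (φ₂ y) (φ₂ k) 0#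
        (trans (sym (φ₂-Ψ (φ₁ y) (φ₂ y) k)) (trans (form-congʳ b Ψ≈y) (sym (+-identityʳ (φ₂ y)))))

  total : q ℕ.* q ℕ.* (q ℕ.* q ℕ.* F) ≡ q ℕ.^ n ℕ.* q ℕ.^ n
  total = card-unique ((λ _ → tt) , (λ _ → tt , tt)) (card-ByValues (λ _ _ → tt) (λ _ _ → tt) card-K card-K) card-V

  NonZero : Pred Carrier ℓ
  NonZero = ∁ (_≈ 0#)

  NonZero-resp : NonZero Respects _≈_
  NonZero-resp x≈y x≉0 y≈0 = x≉0 (trans x≈y y≈0)

  nZ : ℕ
  nZ = proj₁ (card-nonzero _≟_)

  nonzero : 1 ℕ.+ nZ ≡ q ℕ.* q
  nonzero = proj₂ (proj₂ (card-nonzero _≟_))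

  Neighbours : Pred V ℓ
  Neighbours = ByValues NonZero NonZero

  Neighbours-resp : Neighbours Respects _≈ᵥ_
  Neighbours-resp y≈y′ (n₁ , n₂) = NonZero-resp (form-congʳ a y≈y′) n₁ , NonZero-resp (form-congʳ b y≈y′) n₂

  card-Neighbours : Card V-setoid Neighbours (nZ ℕ.* (nZ ℕ.* F))
  card-Neighbours = card-ByValues NonZero-resp NonZero-resp (proj₁ (proj₂ (card-nonzero _≟_))) (proj₁ (proj₂ (card-nonzero _≟_)))

  nU : ℕ
  nU = proj₁ card-Unit

  units : q ℕ.+ nU ≡ q ℕ.* q
  units = proj₂ (proj₂ card-Unit)

  UnitValues : Pred V (c ⊔ ℓ)
  UnitValues = ByValues Unit Unit

  UnitValues-resp : UnitValues Respects _≈ᵥ_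
  UnitValues-resp y≈y′ (u₁ , u₂) = Unit-resp (form-congʳ a y≈y′) u₁ , Unit-resp (form-congʳ b y≈y′) u₂

  UnitValues-digits : ∃[ G ] Card Digits (UnitValues ∘ lift) G
  UnitValues-digits = Prod.map₂ (card-cong (proj₂ , (tt ,_)))
    (card-filter (UnitValues-resp ∘ lift-cong) (λ α → Unit? (φ₁ (lift α)) ×-dec Unit? (φ₂ (lift α))) card-Digits)

  G : ℕ
  G = proj₁ UnitValues-digits

  card-UnitValues-digits : Card Digits (UnitValues ∘ lift) G
  card-UnitValues-digits = proj₂ UnitValues-digits

  shifted-unit : ∀ c {y} z → Unit ⟪ c , y ⟫ → Unit ⟪ c , y +ᵥ r ·ᵥ z ⟫
  shifted-unit c {y} z u = Unit-resp (sym (form-+·ʳ c y r z)) (Unit-+J u (J-resp (*-comm _ r) (J-*r ⟪ c , z ⟫)))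

  shift : nU ℕ.* (nU ℕ.* F) ≡ G ℕ.* q ℕ.^ n
  shift = card-unique ((λ u → u) , (λ u → u))
    (card-ByValues Unit-resp Unit-resp (proj₁ (proj₂ card-Unit)) (proj₁ (proj₂ card-Unit)))
    (card-shift-invariant UnitValues-resp (λ {y} z (u₁ , u₂) → shifted-unit a {y} z u₁ , shifted-unit b {y} z u₂) card-UnitValues-digits)

  r·-nonzero⇒unit : ∀ c z → NonZero ⟪ c , r ·ᵥ z ⟫ → Unit ⟪ c , z ⟫
  r·-nonzero⇒unit c z n = ¬J⇒Unit λ J⟪c,z⟫ → n (trans (form-·ʳ c r z) (r*J≈0 J⟪c,z⟫))

  unit⇒r·-nonzero : ∀ c z → Unit ⟪ c , z ⟫ → NonZero ⟪ c , r ·ᵥ z ⟫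
  unit⇒r·-nonzero c z u r⟪c,z⟫≈0 = unit∉J u (*r≈0⇒J (trans (*-comm _ r) (trans (sym (form-·ʳ c r z)) r⟪c,z⟫≈0)))

  card-Neighbours∩T : Card V-setoid (Neighbours ∩ T) G
  card-Neighbours∩T = card-⊆T (λ y≈y′ → Prod.map (Neighbours-resp y≈y′) (T-resp y≈y′)) proj₂
    (card-cong (from , to) card-UnitValues-digits)
    where
    from : ∀ {β} → UnitValues (lift β) → (Neighbours ∩ T) (r ·ᵥ lift β)
    from {β} (u₁ , u₂) = (unit⇒r·-nonzero a (lift β) u₁ , unit⇒r·-nonzero b (lift β) u₂) , r·ᵥ-T (lift β)
    to : ∀ {β} → (Neighbours ∩ T) (r ·ᵥ lift β) → UnitValues (lift β)
    to {β} ((n₁ , n₂) , _) = r·-nonzero⇒unit a (lift β) n₁ , r·-nonzero⇒unit b (lift β) n₂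

  Vertex : Pred V (c ⊔ ℓ)
  Vertex = InV' K

  Vertex-resp : Vertex Respects _≈ᵥ_
  Vertex-resp y≈y′ (j , u) = j , Unit-resp (y≈y′ j) u

  Vertex? : Decidable₁ Vertex
  Vertex? y = Finₚ.any? (Unit? ∘ coord y)

  ¬Vertex⇒T : ∀ {y} → ¬ Vertex y → T y
  ¬Vertex⇒T {y} ¬V j = Sum.[ (λ u → contradiction (j , u) ¬V) , (λ Jyⱼ → Jyⱼ) ]′ (unit⊎J (coord y j))

  N′ : ℕ
  N′ = proj₁ (card-filter Vertex-resp Vertex? card-Neighbours)

  card-VertexNeighbours : Card V-setoid (Neighbours ∩ Vertex) N′
  card-VertexNeighbours = proj₂ (card-filter Vertex-resp Vertex? card-Neighbours)

  split : G ℕ.+ N′ ≡ nZ ℕ.* (nZ ℕ.* F)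
  split = card-unique (Sum.[ proj₁ , proj₁ ]′ , λ {y} n → Sum.map (n ,_) (n ,_) (Sum.swap (Sum.map₂ ¬Vertex⇒T (toSum (Vertex? y)))))
    (card-∪ (λ y≈y′ → Prod.map (Neighbours-resp y≈y′) (Vertex-resp y≈y′)) (λ (_ , Ty) (_ , j , u) → unit∉J u (Ty j))
            card-Neighbours∩T card-VertexNeighbours)
    card-Neighbours

  open LeadingUnit K r ideals

  lead : V → Carrier
  lead x = leading (coord x)

  Normalised : Pred V ℓ
  Normalised x = lead x ≈ 1#

  Representative : Pred V (c ⊔ ℓ)
  Representative = (Neighbours ∩ Vertex) ∩ Normalised

  Representative-count : ∃[ N ] Card V-setoid Representative N
  Representative-count = card-filter (λ x≈y lx≈1 → trans (sym (leading-cong x≈y)) lx≈1) (λ x → lead x ≟ 1#) card-VertexNeighbours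

  N : ℕ
  N = proj₁ Representative-count

  card-Representative : Card V-setoid Representative N
  card-Representative = proj₂ Representative-count

  lead-scale-normalised : ∀ {λ′ x} → Unit λ′ → Vertex x → Normalised x → lead (λ′ ·ᵥ x) ≈ λ′
  lead-scale-normalised {λ′} {x} λ′-unit x∈V′ lx≈1 =
    trans (leading-scale (coord x) λ′-unit x∈V′) (trans (*-congˡ lx≈1) (*-identityʳ λ′))

  scale-Neighbours∩Vertex : ∀ {λ′ x} → Unit λ′ → (Neighbours ∩ Vertex) x → (Neighbours ∩ Vertex) (λ′ ·ᵥ x)
  scale-Neighbours∩Vertex {λ′} {x} λ′-unit ((n₁ , n₂) , j , xⱼ-unit) =
    (scale-nonzero a n₁ , scale-nonzero b n₂) , j , Unit-* λ′-unit xⱼ-unit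
    where
    scale-nonzero : ∀ c → NonZero ⟪ c , x ⟫ → NonZero ⟪ c , λ′ ·ᵥ x ⟫
    scale-nonzero c n λ′⟪c,x⟫≈0 = n (x*u≈0⇒x≈0 λ′-unit (trans (*-comm _ λ′) (trans (sym (form-·ʳ c λ′ x)) λ′⟪c,x⟫≈0)))

  record Normalisation (y : V) : Set (c ⊔ ℓ) where
    field
      ŷ : V
      ŷ-representative : Representative ŷ
      y≈lead·ŷ : y ≈ᵥ lead y ·ᵥ ŷ

  normalise : ∀ {y} → (Neighbours ∩ Vertex) y → Normalisation y
  normalise {y} y∈ = record { ŷ = ŷ ; ŷ-representative = scale-Neighbours∩Vertex ℓ⁻¹-unit y∈ , lead-ŷ≈1 ; y≈lead·ŷ = y≈ }
    where
    ℓ-unit : Unit (lead y)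
    ℓ-unit = leading-unit (coord y) (proj₂ y∈)
    ℓ⁻¹ : Carrier
    ℓ⁻¹ = proj₁ ℓ-unit
    ℓ⁻¹-unit : Unit ℓ⁻¹
    ℓ⁻¹-unit = Unit-inverse ℓ-unit
    ŷ : V
    ŷ = ℓ⁻¹ ·ᵥ y
    lead-ŷ≈1 : lead ŷ ≈ 1#
    lead-ŷ≈1 = trans (leading-scale (coord y) ℓ⁻¹-unit (proj₂ y∈)) (trans (*-comm ℓ⁻¹ _) (proj₂ ℓ-unit))
    y≈ : y ≈ᵥ lead y ·ᵥ ŷ
    y≈ j = begin
      coord y j                    ≈⟨ *-identityˡ _ ⟨
      1# * coord y j               ≈⟨ *-congʳ (proj₂ ℓ-unit) ⟨
      (lead y * ℓ⁻¹) * coord y j   ≈⟨ *-assoc _ _ _ ⟩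
      lead y * (ℓ⁻¹ * coord y j)   ∎

  ·ᵥ-cancel : ∀ {λ′ x y} → Unit λ′ → λ′ ·ᵥ x ≈ᵥ λ′ ·ᵥ y → x ≈ᵥ y
  ·ᵥ-cancel {λ′} {x} {y} (λ′⁻¹ , λ′λ′⁻¹≈1) λ′x≈λ′y j = begin
    coord x j                    ≈⟨ *-identityˡ _ ⟨
    1# * coord x j               ≈⟨ *-congʳ (trans (*-comm λ′⁻¹ λ′) λ′λ′⁻¹≈1) ⟨
    (λ′⁻¹ * λ′) * coord x j      ≈⟨ *-assoc _ _ _ ⟩
    λ′⁻¹ * (λ′ * coord x j)      ≈⟨ *-congˡ (λ′x≈λ′y j) ⟩
    λ′⁻¹ * (λ′ * coord y j)      ≈⟨ *-assoc _ _ _ ⟨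
    (λ′⁻¹ * λ′) * coord y j      ≈⟨ *-congʳ (trans (*-comm λ′⁻¹ λ′) λ′λ′⁻¹≈1) ⟩
    1# * coord y j               ≈⟨ *-identityˡ _ ⟩
    coord y j                    ∎

  scales-of-representatives : ∀ {λ′ μ x y} → Representative x → Representative y → Unit λ′ → Unit μ →
                              λ′ ·ᵥ x ≈ᵥ μ ·ᵥ y → λ′ ≈ μ
  scales-of-representatives ((_ , x∈V′) , lx≈1) ((_ , y∈V′) , ly≈1) λ′-unit μ-unit λ′x≈μy =
    trans (sym (lead-scale-normalised λ′-unit x∈V′ lx≈1)) (trans (leading-cong λ′x≈μy) (lead-scale-normalised μ-unit y∈V′ ly≈1))

  orbits : N ℕ.* nU ≡ N′
  orbits = card-unique ((λ x∈ → x∈) , (λ x∈ → x∈))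
    (card-map {P = Representative ⟨×⟩ Unit} (λ (x , λ′) → λ′ ·ᵥ x) (λ (x≈ , λ′≈) j → *-cong λ′≈ (x≈ j))
       (λ (x-rep , λ′-unit) → scale-Neighbours∩Vertex λ′-unit (proj₁ x-rep)) inj onto
       (card-× card-Representative (proj₁ (proj₂ card-Unit))))
    card-VertexNeighbours
    where
    inj : ∀ {u v} → (Representative ⟨×⟩ Unit) u → (Representative ⟨×⟩ Unit) v → proj₂ u ·ᵥ proj₁ u ≈ᵥ proj₂ v ·ᵥ proj₁ v →
          Setoid._≈_ (×-setoid V-setoid setoid) u v
    inj {x , λ′} {y , μ} (x-rep , λ′-unit) (y-rep , μ-unit) λ′x≈μy = x≈y , λ′≈μ
      where
      λ′≈μ : λ′ ≈ μ
      λ′≈μ = scales-of-representatives x-rep y-rep λ′-unit μ-unit λ′x≈μy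
      x≈y : x ≈ᵥ y
      x≈y = ·ᵥ-cancel λ′-unit λ j → trans (λ′x≈μy j) (*-congʳ (sym λ′≈μ))
    onto : ∀ {y} → (Neighbours ∩ Vertex) y → ∃[ u ] (Representative ⟨×⟩ Unit) u × proj₂ u ·ᵥ proj₁ u ≈ᵥ y
    onto {y} y∈ = (ŷ , lead y) , (ŷ-representative , leading-unit (coord y) (proj₂ y∈)) , sym ∘ y≈lead·ŷ
      where open Normalisation (normalise y∈)

  representative : Fin N → V
  representative = elem card-Representative

  hasVertexCount : HasVertexCount K (CommonNeighbour K a b) N
  hasVertexCount = representative , (λ i → Prod.swap (proj₁ (elem∈ card-Representative i))) , distinct , cover
    where
    distinct : ∀ i j → SameVertex K (representative i) (representative j) → i ≡ j
    distinct i j (λ′ , λ′-unit , wⱼ≈λ′wᵢ) = elem-inj card-Representative λ k → begin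
      coord (representative i) k           ≈⟨ *-identityˡ _ ⟨
      1# * coord (representative i) k      ≈⟨ *-congʳ λ′≈1 ⟨
      λ′ * coord (representative i) k      ≈⟨ wⱼ≈λ′wᵢ k ⟨
      coord (representative j) k           ∎
      where
      λ′≈1 : λ′ ≈ 1#
      λ′≈1 = scales-of-representatives (elem∈ card-Representative i) (elem∈ card-Representative j) λ′-unit Unit-1
               λ k → trans (sym (wⱼ≈λ′wᵢ k)) (sym (*-identityˡ _))
    cover : ∀ x → InV' K x → CommonNeighbour K a b x → ∃[ i ] SameVertex K (representative i) x
    cover x x∈V′ x-neighbour = proj₁ found , lead x , leading-unit (coord x) x∈V′ , λ j → trans (y≈lead·ŷ j) (*-congˡ (sym (proj₂ found j)))
      where
      open Normalisation (normalise (x-neighbour , x∈V′))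
      found : ∃[ i ] representative i ≈ᵥ ŷ
      found = elem-cover card-Representative ŷ-representative

  identities : CountingIdentities q n N
  identities = record
    { F = F ; nZ = nZ ; nU = nU ; G = G ; N′ = N′
    ; total = total ; nonzero = nonzero ; units = units ; split = split ; shift = shift ; orbits = orbits }

pos-^ : ∀ m n → + (m ℕ.^ n) ≡ (+ m) ℤ.^ n
pos-^ m zero    = ≡.refl
pos-^ m (suc n) = ≡.trans (ℤₚ.pos-* m (m ℕ.^ n)) (≡.cong (+ m ℤ.*_) (pos-^ m n))

∸-cancel : ∀ c i j m → c ≡ j ℕ.+ i → c ℕ.+ m ∸ j ≡ i ℕ.+ m
∸-cancel c i j m c≡j+i = ≡.trans (≡.cong (λ c → c ℕ.+ m ∸ j) c≡j+i)
  (≡.trans (≡.cong (_∸ j) (ℕₚ.+-assoc j i m)) (ℕₚ.m+n∸m≡n j (i ℕ.+ m)))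

module FormulaArithmetic (p k : ℕ) where
  open import Data.Integer using (_+_; _-_; _*_; _^_)
  open ≡.≡-Reasoning

  -- With q = 2 + p and e = 2 + k, every power in the formula is q^i X² or q^i X for X = q^(2k).
  q e X : ℕ
  q = 2 ℕ.+ p
  e = 2 ℕ.+ k
  X = q ℕ.^ (2 ℕ.* k)

  qℤ Xℤ : ℤ
  qℤ = + q
  Xℤ = + X

  formulaℤ : ℤ
  formulaℤ = qℤ ^ 6 * (Xℤ * Xℤ) + qℤ ^ 5 * (Xℤ * Xℤ) - qℤ ^ 4 * (Xℤ * Xℤ) - qℤ ^ 3 * (Xℤ * Xℤ) - qℤ ^ 2 * Xℤ + qℤ ^ 1 * Xℤ

  q^[i+m] : ∀ i m → + (q ℕ.^ (i ℕ.+ m)) ≡ qℤ ^ i * + (q ℕ.^ m)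
  q^[i+m] i m = begin
    + (q ℕ.^ (i ℕ.+ m))           ≡⟨ ≡.cong +_ (ℕₚ.^-distribˡ-+-* q i m) ⟩
    + (q ℕ.^ i ℕ.* q ℕ.^ m)       ≡⟨ ℤₚ.pos-* (q ℕ.^ i) (q ℕ.^ m) ⟩
    + (q ℕ.^ i) * + (q ℕ.^ m)     ≡⟨ ≡.cong (_* + (q ℕ.^ m)) (pos-^ q i) ⟩
    qℤ ^ i * + (q ℕ.^ m)          ∎

  q^[4e∸j] : ∀ i j → 8 ≡ j ℕ.+ i → + (q ℕ.^ (4 ℕ.* e ∸ j)) ≡ qℤ ^ i * (Xℤ * Xℤ)
  q^[4e∸j] i j 8≡j+i = begin
    + (q ℕ.^ (4 ℕ.* e ∸ j))                       ≡⟨ ≡.cong (λ m → + (q ℕ.^ (m ∸ j))) (4e k) ⟩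
    + (q ℕ.^ (8 ℕ.+ (2 ℕ.* k ℕ.+ 2 ℕ.* k) ∸ j))   ≡⟨ ≡.cong (λ m → + (q ℕ.^ m)) (∸-cancel 8 i j _ 8≡j+i) ⟩
    + (q ℕ.^ (i ℕ.+ (2 ℕ.* k ℕ.+ 2 ℕ.* k)))       ≡⟨ q^[i+m] i _ ⟩
    qℤ ^ i * + (q ℕ.^ (2 ℕ.* k ℕ.+ 2 ℕ.* k))      ≡⟨ ≡.cong (λ m → qℤ ^ i * + m) (ℕₚ.^-distribˡ-+-* q (2 ℕ.* k) (2 ℕ.* k)) ⟩
    qℤ ^ i * + (X ℕ.* X)                          ≡⟨ ≡.cong (qℤ ^ i *_) (ℤₚ.pos-* X X) ⟩
    qℤ ^ i * (Xℤ * Xℤ)                            ∎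
    where
    4e : ∀ k → 4 ℕ.* (2 ℕ.+ k) ≡ 8 ℕ.+ (2 ℕ.* k ℕ.+ 2 ℕ.* k)
    4e = ℕ-Solver.solve-∀

  q^[2e∸j] : ∀ i j → 4 ≡ j ℕ.+ i → + (q ℕ.^ (2 ℕ.* e ∸ j)) ≡ qℤ ^ i * Xℤ
  q^[2e∸j] i j 4≡j+i = begin
    + (q ℕ.^ (2 ℕ.* e ∸ j))           ≡⟨ ≡.cong (λ m → + (q ℕ.^ (m ∸ j))) (2e k) ⟩
    + (q ℕ.^ (4 ℕ.+ 2 ℕ.* k ∸ j))     ≡⟨ ≡.cong (λ m → + (q ℕ.^ m)) (∸-cancel 4 i j _ 4≡j+i) ⟩
    + (q ℕ.^ (i ℕ.+ 2 ℕ.* k))         ≡⟨ q^[i+m] i _ ⟩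
    qℤ ^ i * Xℤ                       ∎
    where
    2e : ∀ k → 2 ℕ.* (2 ℕ.+ k) ≡ 4 ℕ.+ 2 ℕ.* k
    2e = ℕ-Solver.solve-∀

  commonNeighbourFormula≡ : commonNeighbourFormula q e ≡ formulaℤ
  commonNeighbourFormula≡ =
    ≡.cong₂ _+_ (≡.cong₂ _-_ (≡.cong₂ _-_ (≡.cong₂ _-_ (≡.cong₂ _+_
      (q^[4e∸j] 6 2 ≡.refl) (q^[4e∸j] 5 3 ≡.refl)) (q^[4e∸j] 4 4 ≡.refl)) (q^[4e∸j] 3 5 ≡.refl))
      (q^[2e∸j] 2 2 ≡.refl)) (q^[2e∸j] 1 3 ≡.refl)

  +-moveˡ : ∀ {a b c} → a + b ≡ c → b ≡ c - a
  +-moveˡ {a} {b} a+b≡c = ≡.trans (b≡a+b-a a b) (≡.cong (_- a) a+b≡c)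
    where
    b≡a+b-a : ∀ a b → b ≡ (a + b) - a
    b≡a+b-a = ℤ-Solver.solve-∀

  module _ {N : ℕ} (ids : CountingIdentities q (e ℕ.+ e) N) where
    open CountingIdentities ids

    q^[e+e] : q ℕ.^ (e ℕ.+ e) ≡ q ℕ.^ 4 ℕ.* X
    q^[e+e] = ≡.trans (≡.cong (q ℕ.^_) (e+e k)) (ℕₚ.^-distribˡ-+-* q 4 (2 ℕ.* k))
      where
      e+e : ∀ k → (2 ℕ.+ k) ℕ.+ (2 ℕ.+ k) ≡ 4 ℕ.+ 2 ℕ.* k
      e+e = ℕ-Solver.solve-∀

    F≡ : F ≡ q ℕ.^ 4 ℕ.* (X ℕ.* X)
    F≡ = ℕₚ.*-cancelʳ-≡ F _ (q ℕ.^ 4) (begin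
      F ℕ.* q ℕ.^ 4                              ≡⟨ l₁ q F ⟩
      q ℕ.* q ℕ.* (q ℕ.* q ℕ.* F)                ≡⟨ total ⟩
      q ℕ.^ (e ℕ.+ e) ℕ.* q ℕ.^ (e ℕ.+ e)        ≡⟨ ≡.cong₂ ℕ._*_ q^[e+e] q^[e+e] ⟩
      q ℕ.^ 4 ℕ.* X ℕ.* (q ℕ.^ 4 ℕ.* X)          ≡⟨ l₂ (q ℕ.^ 4) X ⟩
      q ℕ.^ 4 ℕ.* (X ℕ.* X) ℕ.* q ℕ.^ 4          ∎)
      where
      l₁ : ∀ q F → F ℕ.* (q ℕ.* (q ℕ.* (q ℕ.* (q ℕ.* 1)))) ≡ q ℕ.* q ℕ.* (q ℕ.* q ℕ.* F)
      l₁ = ℕ-Solver.solve-∀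
      l₂ : ∀ Q X → Q ℕ.* X ℕ.* (Q ℕ.* X) ≡ Q ℕ.* (X ℕ.* X) ℕ.* Q
      l₂ = ℕ-Solver.solve-∀

    G≡ : G ≡ nU ℕ.* nU ℕ.* X
    G≡ = ≡.sym (ℕₚ.*-cancelʳ-≡ _ G (q ℕ.^ 4 ℕ.* X) {{ℕₚ.m*n≢0 (q ℕ.^ 4) X {{_}} {{ℕₚ.m^n≢0 q (2 ℕ.* k)}}}} (begin
      nU ℕ.* nU ℕ.* X ℕ.* (q ℕ.^ 4 ℕ.* X)         ≡⟨ l nU (q ℕ.^ 4) X ⟩
      nU ℕ.* (nU ℕ.* (q ℕ.^ 4 ℕ.* (X ℕ.* X)))     ≡⟨ ≡.cong (λ F → nU ℕ.* (nU ℕ.* F)) F≡ ⟨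
      nU ℕ.* (nU ℕ.* F)                          ≡⟨ shift ⟩
      G ℕ.* q ℕ.^ (e ℕ.+ e)                      ≡⟨ ≡.cong (G ℕ.*_) q^[e+e] ⟩
      G ℕ.* (q ℕ.^ 4 ℕ.* X)                      ∎))
      where
      l : ∀ u Q X → u ℕ.* u ℕ.* X ℕ.* (Q ℕ.* X) ≡ u ℕ.* (u ℕ.* (Q ℕ.* (X ℕ.* X)))
      l = ℕ-Solver.solve-∀

    nU≡ : + nU ≡ qℤ * qℤ - qℤ
    nU≡ = +-moveˡ {qℤ} (≡.trans (≡.sym (ℤₚ.pos-+ q nU)) (≡.trans (≡.cong +_ units) (ℤₚ.pos-* q q)))

    nZ≡ : + nZ ≡ qℤ * qℤ - + 1
    nZ≡ = +-moveˡ {+ 1} (≡.trans (≡.sym (ℤₚ.pos-+ 1 nZ)) (≡.trans (≡.cong +_ nonzero) (ℤₚ.pos-* q q)))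

    Fℤ≡ : + F ≡ qℤ ^ 4 * (Xℤ * Xℤ)
    Fℤ≡ = ≡.trans (≡.cong +_ F≡) (≡.trans (ℤₚ.pos-* (q ℕ.^ 4) (X ℕ.* X)) (≡.cong₂ _*_ (pos-^ q 4) (ℤₚ.pos-* X X)))

    Gℤ≡ : + G ≡ + nU * + nU * Xℤ
    Gℤ≡ = ≡.trans (≡.cong +_ G≡) (≡.trans (ℤₚ.pos-* (nU ℕ.* nU) X) (≡.cong (_* Xℤ) (ℤₚ.pos-* nU nU)))

    N*nU≡ : + N * + nU ≡ + nZ * (+ nZ * + F) - + G
    N*nU≡ = begin
      + N * + nU                    ≡⟨ ≡.trans (≡.sym (ℤₚ.pos-* N nU)) (≡.cong +_ orbits) ⟩
      + N′                          ≡⟨ +-moveˡ {+ G} (≡.trans (≡.sym (ℤₚ.pos-+ G N′)) (≡.cong +_ split)) ⟩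
      + (nZ ℕ.* (nZ ℕ.* F)) - + G   ≡⟨ ≡.cong (_- + G) (≡.trans (ℤₚ.pos-* nZ (nZ ℕ.* F)) (≡.cong (+ nZ *_) (ℤₚ.pos-* nZ F))) ⟩
      + nZ * (+ nZ * + F) - + G     ∎

    instance
      nU-nonZero : ℕ.NonZero nU
      nU-nonZero = ≡.subst ℕ.NonZero (≡.sym (ℕₚ.+-cancelˡ-≡ q nU (suc p ℕ.* q) units)) _

    N≡formula : + N ≡ commonNeighbourFormula q e
    N≡formula = ≡.trans (ℤₚ.*-cancelʳ-≡ (+ N) formulaℤ (+ nU) (begin
      + N * + nU
        ≡⟨ N*nU≡ ⟩
      + nZ * (+ nZ * + F) - + G
        ≡⟨ ≡.cong₂ (λ z F → z * (z * F) - + G) nZ≡ Fℤ≡ ⟩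
      (qℤ * qℤ - + 1) * ((qℤ * qℤ - + 1) * (qℤ ^ 4 * (Xℤ * Xℤ))) - + G
        ≡⟨ ≡.cong (λ G → (qℤ * qℤ - + 1) * ((qℤ * qℤ - + 1) * (qℤ ^ 4 * (Xℤ * Xℤ))) - G) (≡.trans Gℤ≡ (≡.cong (λ u → u * u * Xℤ) nU≡)) ⟩
      (qℤ * qℤ - + 1) * ((qℤ * qℤ - + 1) * (qℤ ^ 4 * (Xℤ * Xℤ))) - (qℤ * qℤ - qℤ) * (qℤ * qℤ - qℤ) * Xℤ
        ≡⟨ polynomial qℤ Xℤ ⟩
      formulaℤ * (qℤ * qℤ - qℤ)
        ≡⟨ ≡.cong (formulaℤ *_) nU≡ ⟨
      formulaℤ * + nU
        ∎)) (≡.sym commonNeighbourFormula≡)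
      where
      polynomial : ∀ q X →
        let q¹ = q * + 1
            q² = q * q¹
            q³ = q * q²
            q⁴ = q * q³
            q⁵ = q * q⁴
            q⁶ = q * q⁵
        in (q * q - + 1) * ((q * q - + 1) * (q⁴ * (X * X))) - (q * q - q) * (q * q - q) * X
           ≡ (q⁶ * (X * X) + q⁵ * (X * X) - q⁴ * (X * X) - q³ * (X * X) - q² * X + q¹ * X) * (q * q - q)
      polynomial = ℤ-Solver.solve-∀

counting⇒formula : ∀ {q e N} → 2 ≤ q → 2 ≤ e → CountingIdentities q (e ℕ.+ e) N → + N ≡ commonNeighbourFormula q e
counting⇒formula {suc (suc p)} {suc (suc k)} (s≤s (s≤s z≤n)) (s≤s (s≤s z≤n)) = FormulaArithmetic.N≡formula p k

primePower≥2 : ∀ {q} → IsPrimePower q → 2 ≤ q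
primePower≥2 (p , suc k , p-prime , _ , ≡.refl) = ℕₚ.≤-trans
  (ℕ.nonTrivial⇒n>1 p {{prime⇒nonTrivial p-prime}}) (ℕₚ.m≤m*n p (p ℕ.^ k) {{ℕₚ.m^n≢0 p k {{prime⇒nonZero p-prime}}}})

proportional⇒sameClass : ∀ {c ℓ ℓh} (K : CommutativeRing c ℓ) (r : CommutativeRing.Carrier K)
  (ideals : ExactlyThreeIdeals K r) (q : ℕ) → ResidueFieldSize K r q → Decidable (CommutativeRing._≈_ K) →
  (e : ℕ) → 1 ≤ e → (H₁ H₂ : Pred (Vect K e) ℓh) → IsHyperplane K r e H₁ → IsHyperplane K r e H₂ →
  ∀ {a b} → ¬ H₁ (Defs._·ᵥ_ K r a) → ¬ H₂ (Defs._·ᵥ_ K r b) →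
  Dichotomy.ProportionalModJ K r ideals e a b → SameClassC K r e H₁ a H₂ b
proportional⇒sameClass K r ideals q residues _≟_ e 1≤e H₁ H₂ hyp₁ hyp₂ ra∉H₁ rb∉H₂ a∼b x _ = mk⇔
  (λ x∈C₁ → H₂.proportional⇒inClass rb∉H₂ 1≤e (proportional-trans (proportional-sym a∼b) (H₁.inClass⇒proportional x∈C₁)))
  (λ x∈C₂ → H₁.proportional⇒inClass ra∉H₁ 1≤e (proportional-trans a∼b (H₂.inClass⇒proportional x∈C₂)))
  where
  module H₁ = Hyperplane K r ideals q residues _≟_ e H₁ hyp₁
  module H₂ = Hyperplane K r ideals q residues _≟_ e H₂ hyp₂
  open Dichotomy K r ideals e using (proportional-trans; proportional-sym)

open Defs using (_·ᵥ_)

corollary3p12 : ∀ {c ℓ ℓh : Level} (K : CommutativeRing c ℓ)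
    (r : CommutativeRing.Carrier K) (q e : ℕ) →
    2 ≤ e →
    IsFiniteRing K →
    Decidable (CommutativeRing._≈_ K) →
    ExactlyThreeIdeals K r →
    IsPrimePower q →
    ResidueFieldSize K r q →
    (H₁ H₂ : Pred (Vect K e) ℓh) →
    IsHyperplane K r e H₁ → IsHyperplane K r e H₂ →
    (a b : Vect K e) → InV' K a → InV' K b →
    ¬ H₁ (_·ᵥ_ K r a) → ¬ H₂ (_·ᵥ_ K r b) →
    ¬ SameClassC K r e H₁ a H₂ b →
    Σ ℕ (λ N → HasVertexCount K (CommonNeighbour K a b) N × + N ≡ commonNeighbourFormula q e)
corollary3p12 K r q e 2≤e _ _≟_ ideals q-primePower residues H₁ H₂ hyp₁ hyp₂ a b a∈V′ b∈V′ ra∉H₁ rb∉H₂ distinct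
  with Dichotomy.dualPair⊎proportional K r ideals e a∈V′ b∈V′
... | inj₂ a∼b  = ⊥-elim (distinct (proportional⇒sameClass K r ideals q residues _≟_ e (ℕₚ.≤-trans (s≤s z≤n) 2≤e)
                                      H₁ H₂ hyp₁ hyp₂ ra∉H₁ rb∉H₂ a∼b))
... | inj₁ pair = N , hasVertexCount , counting⇒formula (primePower≥2 q-primePower) 2≤e identities
  where open CommonNeighbourCount K r ideals q residues _≟_ e pair
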